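{- Let $X$ be a finite set of clocks, $\alpha:X\to\mathbb{N}$ a bound function, $Z$ a non-empty zone over $X$, and $x\in X$. Then, among all regions $R$ (with respect to $\alpha$) that intersect $Z$: (i) the least value of $R_{0x}$ is $(<,\infty)$ if $Z_{x0}<(\le,-\alpha_x)$, and $\lceil -Z_{x0}\rceil$ otherwise; (ii) the least value of $R_{x0}$ is $\max\{\lceil -Z_{0x}\rceil,(<,-\alpha_x)\}$.
   Context: Clock valuations are maps $X\to\mathbb{R}_{\ge0}$; a zone is a set of valuations defined by a conjunction of constraints $x-y\,\#\,c$ or $x\,\#\,c$ with $c\in\mathbb{N}$, $\#\in\{<,\le,=,\ge,>\}$. Weights are pairs $(\preccurlyeq,c)$, $\preccurlyeq\in\{\le,<\}$, $c\in\mathbb{Z}\cup\{\pm\infty\}$, ordered by $(\preccurlyeq_1,c_1)<(\preccurlyeq_2,c_2)$ iff $c_1<c_2$ or ($c_1=c_2$, $\preccurlyeq_1$ is $<$, $\preccurlyeq_2$ is $\le$); negation $-(\preccurlyeq,c)=(\preccurlyeq,-c)$; ceiling (for integer $c$) $\lceil(\le,c)\rceil=(\le,c)$ and $\lceil(<,c)\rceil=(<,c+1)$. A distance graph has vertices $X\cup\{x_0\}$ ($x_0$ a special clock equal to $0$, written $0$ in subscripts) and an edge $x\to y$ of weight $(\preccurlyeq,c)$ for each ordered pair, representing $y-x\preccurlyeq c$; it is canonical if every edge weight equals the least weight of a path between its endpoints. $Z_{xy}$ (resp. $R_{xy}$) denotes the weight of edge $x\to y$ in the canonical distance graph representing $Z$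 (resp. the constraints defining region $R$). A region w.r.t. $\alpha$ is specified by: for each clock $x$ one constraint among $x=c$ ($c=0,\dots,\alpha_x$), $c-1<x<c$ ($c=1,\dots,\alpha_x$), $x>\alpha_x$; and for each pair of clocks in open unit intervals, the ordering of their fractional parts.
   Formalization: Clock valuations take values in the non-negative rationals instead of $\mathbb{R}_{\ge0}$, so the non-emptiness of Z and the regions intersecting Z refer to rational valuations. -}

module Defs where

open import Data.Bool using (Bool; true; false; T; not; _∧_; _∨_; if_then_else_)
open import Data.Nat as ℕ using (ℕ; zero; suc)
open import Data.Integer as ℤ using (ℤ; +_; _-_)
import Data.Integer.Properties as ℤP
open import Data.Rational as ℚ using (ℚ; _/_)
open import Data.Fin using (Fin; toℕ) renaming (zero to fzero; suc to fsuc)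
open import Data.List using (List; []; _∷_)
open import Data.Product using (Σ; ∃; _×_; _,_)
open import Data.Empty using (⊥)
open import Data.Unit using (⊤)
open import Relation.Nullary using (¬_)
open import Relation.Nullary.Decidable using (⌊_⌋)
open import Relation.Binary.PropositionalEquality using (_≡_)

-- Weights (≼, c) with ≼ ∈ {≤, <} and c ∈ ℤ ∪ {±∞}.
-- The infinite weights are (<, ∞) and (<, -∞).

data Strict : Set where
  lt le : Strict

data Weight : Set where
  fin  : Strict → ℤ → Weight
  ∞    : Weight
  -∞   : Weight

_<ᵇ_ : Weight → Weight → Bool
-∞      <ᵇ -∞      = false
-∞      <ᵇ _       = true
fin _ _ <ᵇ -∞      = false
fin s c <ᵇ fin t d = ⌊ c ℤ.<? d ⌋ ∨ (⌊ c ℤ.≟ d ⌋ ∧ isLtLe s t)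
  where
  isLtLe : Strict → Strict → Bool
  isLtLe lt le = true
  isLtLe _  _  = false
fin _ _ <ᵇ ∞       = true
∞       <ᵇ _       = false

_<w_ : Weight → Weight → Set
a <w b = T (a <ᵇ b)

_≤w_ : Weight → Weight → Set
a ≤w b = T (not (b <ᵇ a))

maxw : Weight → Weight → Weight
maxw a b = if a <ᵇ b then b else a

negw : Weight → Weight
negw (fin s c) = fin s (ℤ.- c)
negw ∞         = -∞
negw -∞        = ∞

ceilw : Weight → Weight
ceilw (fin le c) = fin le c
ceilw (fin lt c) = fin lt (c ℤ.+ ℤ.1ℤ)
ceilw ∞          = ∞
ceilw -∞         = -∞

_+w_ : Weight → Weight → Weight
-∞       +w _         = -∞
_        +w -∞        = -∞
∞        +w _         = ∞
fin _ _  +w ∞         = ∞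
fin s c  +w fin t d   = fin (minS s t) (c ℤ.+ d)
  where
  minS : Strict → Strict → Strict
  minS le le = le
  minS _  _  = lt

-- Distance graphs over clocks X = Fin n; vertex fzero is x₀,
-- vertex fsuc x is the clock x.

Vertex : ℕ → Set
Vertex n = Fin (suc n)

-- edge i → j of weight w represents  j - i ≼ w
DistGraph : ℕ → Set
DistGraph n = Vertex n → Vertex n → Weight

pathWeight : ∀ {n} → DistGraph n → Vertex n → List (Vertex n) → Vertex n → Weight
pathWeight G i []       j = G i j
pathWeight G i (k ∷ ks) j = G i k +w pathWeight G k ks j

-- w is the least weight of a path from i to j in G, i.e. w is the
-- weight of edge i → j in the canonical distance graph equivalent to G.
LeastPath : ∀ {n} → DistGraph n → Vertex n → Vertex n → Weight → Set
LeastPath G i j w =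
  (∃ λ ks → pathWeight G i ks j ≡ w) × (∀ ks → w ≤w pathWeight G i ks j)

Valuation : ℕ → Set
Valuation n = Fin n → ℚ

NonNeg : ∀ {n} → Valuation n → Set
NonNeg v = ∀ x → ℚ.0ℚ ℚ.≤ v x

val : ∀ {n} → Valuation n → Vertex n → ℚ
val v fzero    = ℚ.0ℚ
val v (fsuc x) = v x

toℚ : ℤ → ℚ
toℚ c = c / 1

SatW : ℚ → Weight → Set
SatW d (fin le c) = d ℚ.≤ toℚ c
SatW d (fin lt c) = d ℚ.< toℚ c
SatW d ∞          = ⊤
SatW d -∞         = ⊥

_∈⟦_⟧ : ∀ {n} → Valuation n → DistGraph n → Set
v ∈⟦ G ⟧ = NonNeg v × (∀ i j → SatW (val v j ℚ.- val v i) (G i j))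

data ClockCon (a : ℕ) : Set where
  eqc : (c : ℕ) → c ℕ.≤ a → ClockCon a
  btw : (c : ℕ) → 1 ℕ.≤ c → c ℕ.≤ a → ClockCon a        -- c-1 < x < c,    1 ≤ c ≤ a
  gtc : ClockCon a

data Cmp : Set where
  lessF equalF greaterF : Cmp

-- A region specification: one constraint per clock, and for each pair
-- of clocks x, y with toℕ x < toℕ y the ordering of their fractional
-- parts (only relevant when both are in open unit intervals).
record Region {n : ℕ} (α : Fin n → ℕ) : Set where
  field
    con : (x : Fin n) → ClockCon (α x)
    ord : Fin n → Fin n → Cmp
open Region public

isOpen : ∀ {a} → ClockCon a → Bool
isOpen (btw _ _ _) = true
isOpen _           = false

-- the integer c with c-1 < x < c (for open intervals)
upper : ∀ {a} → ClockCon a → ℤ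
upper (eqc c _)   = + c
upper (btw c _ _) = + c
upper gtc         = + 0

frac : ℚ → ℚ
frac q = q ℚ.- toℚ (ℚ.floor q)

SatCmp : Cmp → ℚ → ℚ → Set
SatCmp lessF    p q = p ℚ.< q
SatCmp equalF   p q = p ≡ q
SatCmp greaterF p q = q ℚ.< p

SatClock : ∀ {a} → ClockCon a → ℚ → Set
SatClock (eqc c _)   q = q ≡ toℚ (+ c)
SatClock (btw c _ _) q = toℚ (+ c - ℤ.1ℤ) ℚ.< q × q ℚ.< toℚ (+ c)
SatClock {a} gtc     q = toℚ (+ a) ℚ.< q

_∈ᴿ_ : ∀ {n} {α : Fin n → ℕ} → Valuation n → Region α → Set
_∈ᴿ_ {n} v R =
  NonNeg v ×
  (∀ x → SatClock (con R x) (v x)) ×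
  (∀ x y → T (toℕ x ℕ.<ᵇ toℕ y) → T (isOpen (con R x)) → T (isOpen (con R y)) →
     SatCmp (ord R x y) (frac (v x)) (frac (v y)))

flipC : Cmp → Cmp
flipC lessF    = greaterF
flipC equalF   = equalF
flipC greaterF = lessF

cmpSpec : ∀ {n} {α : Fin n → ℕ} → Region α → Fin n → Fin n → Cmp
cmpSpec R x y =
  if toℕ x ℕ.<ᵇ toℕ y then ord R x y else flipC (ord R y x)

regionGraph : ∀ {n} (α : Fin n → ℕ) → Region α → DistGraph n
regionGraph α R fzero    fzero    = fin le (+ 0)
regionGraph α R fzero    (fsuc x) = up (con R x)
  where
  up : ∀ {a} → ClockCon a → Weight
  up (eqc c _)   = fin le (+ c)
  up (btw c _ _) = fin lt (+ c)
  up gtc         = ∞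
regionGraph α R (fsuc x) fzero    = lo (con R x)
  where
  lo : ∀ {a} → ClockCon a → Weight
  lo (eqc c _)   = fin le (ℤ.- (+ c))
  lo (btw c _ _) = fin lt (ℤ.- (+ c - ℤ.1ℤ))
  lo {a} gtc     = fin lt (ℤ.- (+ a))
regionGraph α R (fsuc y) (fsuc x) =
  if ⌊ toℕ x ℕ.≟ toℕ y ⌋ then fin le (+ 0)
  else if isOpen (con R x) ∧ isOpen (con R y)
       then diag (cmpSpec R x y)
       else ∞
  where
  d : ℤ
  d = upper (con R x) - upper (con R y)
  -- frac x < frac y  ⇔  x - y < ⌊x⌋ - ⌊y⌋, etc.
  diag : Cmp → Weight
  diag lessF    = fin lt d
  diag equalF   = fin le d
  diag greaterF = ∞

IsLeast : (Weight → Set) → Weight → Set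
IsLeast P t = P t × (∀ w → P w → t ≤w w)

-- In a region R the edges 0 → x and x → 0 are their own least paths (the 0-row and the 0-column
-- of a region graph are potentials for it), and they are determined by where v x lies for any
-- v ∈ R. A valuation of the zone satisfies -Zx0 ≼ v x ≼ Z0x, which yields the lower bounds.
--
-- Attaining them needs valuations of the zone with x at, or just inside, the ends of that range.
-- Read a strict bound (<, c) as c - ε with ε infinitesimal. Cycles are nonnegative since the zone
-- is non-empty, so the ε-distances from a source vertex satisfy the triangle inequality, and
-- ε := 1/(M+1), with M bounding all ε-counts, turns them into an exact solution on the vertices
-- reachable from the source. Its pointwise minimum with a high enough translate of a known
-- valuation lies in the zone; the source x puts x at -Zx0, the source 0 puts it at Z0x.

module Submission where

open import Defs
open import Data.Bool using (true; false; T; not; if_then_else_)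
open import Data.Empty using (⊥-elim)
open import Function using (_∘_; case_of_)
open import Data.Fin as Fin using (Fin; toℕ) renaming (zero to fzero; suc to fsuc)
import Data.Fin.Properties as FinP
open import Data.Integer as ℤ using (ℤ; +_; -_)
import Data.Integer.Properties as ℤP
open import Data.Integer.Tactic.RingSolver using (solve-∀)
open import Data.List using (List; []; _∷_; _++_; length; lookup)
import Data.List.Properties as ListP
open import Data.Maybe using (Maybe; just; nothing)
open import Data.Nat as ℕ using (ℕ; zero; suc)
import Data.Nat.Properties as ℕP
open import Data.Product using (∃; ∃₂; _×_; _,_; proj₁; proj₂)
open import Data.Rational as ℚ using (ℚ; _/_)
import Data.Rational.Properties as ℚP
open import Algebra.Properties.Group ℚP.+-0-group using () renaming (⁻¹-involutive to ℚ-neg-involutive)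
open import Data.Rational.Solver using (module +-*-Solver)
open import Data.Rational.Unnormalised as ℚᵘ using (mkℚᵘ; *≤*; *<*; *≡*)
import Data.Rational.Unnormalised.Properties as ℚᵘP
open import Data.Sum using (_⊎_; inj₁; inj₂)
open import Data.Unit using (tt)
open import Relation.Binary.Definitions using (tri<; tri≈; tri>)
open import Relation.Binary.PropositionalEquality
open import Relation.Nullary using (¬_; yes; no)

-- Weights

infix 4 _≤ˢ_ _⊑_

data _≤ˢ_ : Strict → Strict → Set where
  lt≤ˢ  : ∀ {t} → lt ≤ˢ t
  le≤le : le ≤ˢ le

data _⊑_ : Weight → Weight → Set where
  -∞⊑  : ∀ {b} → -∞ ⊑ b
  ⊑∞   : ∀ {a} → a ⊑ ∞
  fin< : ∀ {s t c d} → c ℤ.< d → fin s c ⊑ fin t d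
  fin≡ : ∀ {s t c} → s ≤ˢ t → fin s c ⊑ fin t c

T-not⁺ : ∀ {b} → ¬ T b → T (not b)
T-not⁺ {false} _  = tt
T-not⁺ {true}  ¬b = ¬b tt

T-not⁻ : ∀ {b} → T (not b) → ¬ T b
T-not⁻ {false} _ ()

fin-<ᵇ-inv : ∀ s c t d → T (fin s c <ᵇ fin t d) → c ℤ.< d ⊎ (c ≡ d × s ≡ lt × t ≡ le)
fin-<ᵇ-inv s  c t  d h  with c ℤ.<? d | c ℤ.≟ d
fin-<ᵇ-inv s  c t  d _  | yes c<d | _       = inj₁ c<d
fin-<ᵇ-inv lt c le d _  | no _    | yes c≡d = inj₂ (c≡d , refl , refl)
fin-<ᵇ-inv lt c lt d () | no _    | yes _
fin-<ᵇ-inv le c t  d () | no _    | yes _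
fin-<ᵇ-inv s  c t  d () | no _    | no _

fin-<ᵇ : ∀ s t {c d} → c ℤ.< d → T (fin s c <ᵇ fin t d)
fin-<ᵇ s t {c} {d} c<d with c ℤ.<? d
... | yes _    = tt
... | no  c≮d = ⊥-elim (c≮d c<d)

fin-lt<ᵇle : ∀ c → T (fin lt c <ᵇ fin le c)
fin-lt<ᵇle c with c ℤ.<? c | c ℤ.≟ c
... | yes _ | _      = tt
... | no _  | yes _  = tt
... | no _  | no c≢c = ⊥-elim (c≢c refl)

⊑⇒≤w : ∀ {a b} → a ⊑ b → a ≤w b
⊑⇒≤w a⊑b = T-not⁺ (⊑⇒≮ a⊑b)
  where
  ⊑⇒≮ : ∀ {a b} → a ⊑ b → ¬ T (b <ᵇ a)
  ⊑⇒≮ (-∞⊑ { -∞})    ()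
  ⊑⇒≮ (-∞⊑ {fin _ _}) ()
  ⊑⇒≮ (-∞⊑ {∞})      ()
  ⊑⇒≮ (⊑∞ { -∞})     ()
  ⊑⇒≮ (⊑∞ {fin _ _})  ()
  ⊑⇒≮ (⊑∞ {∞})       ()
  ⊑⇒≮ (fin< {s} {t} {c} {d} c<d) d<c with fin-<ᵇ-inv t d s c d<c
  ... | inj₁ d<c        = ℤP.<-asym c<d d<c
  ... | inj₂ (refl , _) = ℤP.<-irrefl refl c<d
  ⊑⇒≮ (fin≡ {s} {t} {c} s≤t) c<c with fin-<ᵇ-inv t c s c c<c
  ... | inj₁ c<c'              = ℤP.<-irrefl refl c<c'
  ... | inj₂ (_ , refl , refl) = case s≤t of λ ()

≤w⇒⊑ : ∀ {a b} → a ≤w b → a ⊑ b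
≤w⇒⊑ { -∞}     {b}       _ = -∞⊑
≤w⇒⊑ {fin _ _} {∞}       _ = ⊑∞
≤w⇒⊑ {∞}       {∞}       _ = ⊑∞
≤w⇒⊑ {fin s c} {fin t d} h with ℤP.<-cmp c d
... | tri< c<d _ _ = fin< c<d
... | tri> _ _ d<c = ⊥-elim (T-not⁻ h (fin-<ᵇ t s d<c))
≤w⇒⊑ {fin lt c} {fin t  .c} h | tri≈ _ refl _ = fin≡ lt≤ˢ
≤w⇒⊑ {fin le c} {fin le .c} h | tri≈ _ refl _ = fin≡ le≤le
≤w⇒⊑ {fin le c} {fin lt .c} h | tri≈ _ refl _ = ⊥-elim (T-not⁻ h (fin-lt<ᵇle c))

<w⇒⋢ : ∀ {a b} → a <w b → ¬ b ⊑ a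
<w⇒⋢ a<b b⊑a = T-not⁻ (⊑⇒≤w b⊑a) a<b

≮w⇒⊑ : ∀ {a b} → ¬ a <w b → b ⊑ a
≮w⇒⊑ a≮b = ≤w⇒⊑ (T-not⁺ a≮b)

⊑-refl : ∀ {a} → a ⊑ a
⊑-refl { -∞}      = -∞⊑
⊑-refl {∞}        = ⊑∞
⊑-refl {fin lt c} = fin≡ lt≤ˢ
⊑-refl {fin le c} = fin≡ le≤le

⊑-reflexive : ∀ {a b} → a ≡ b → a ⊑ b
⊑-reflexive refl = ⊑-refl

≤ˢ-trans : ∀ {r s t} → r ≤ˢ s → s ≤ˢ t → r ≤ˢ t
≤ˢ-trans lt≤ˢ  _     = lt≤ˢ
≤ˢ-trans le≤le le≤le = le≤le

⊑-trans : ∀ {a b c} → a ⊑ b → b ⊑ c → a ⊑ c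
⊑-trans -∞⊑      _        = -∞⊑
⊑-trans _        ⊑∞       = ⊑∞
⊑-trans (fin< p) (fin< q) = fin< (ℤP.<-trans p q)
⊑-trans (fin< p) (fin≡ _) = fin< p
⊑-trans (fin≡ _) (fin< q) = fin< q
⊑-trans (fin≡ p) (fin≡ q) = fin≡ (≤ˢ-trans p q)

⊑-antisym : ∀ {a b} → a ⊑ b → b ⊑ a → a ≡ b
⊑-antisym -∞⊑          -∞⊑          = refl
⊑-antisym ⊑∞           ⊑∞           = refl
⊑-antisym (fin< p)     (fin< q)     = ⊥-elim (ℤP.<-asym p q)
⊑-antisym (fin< p)     (fin≡ _)     = ⊥-elim (ℤP.<-irrefl refl p)
⊑-antisym (fin≡ _)     (fin< q)     = ⊥-elim (ℤP.<-irrefl refl q)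
⊑-antisym (fin≡ lt≤ˢ)  (fin≡ lt≤ˢ)  = refl
⊑-antisym (fin≡ le≤le) (fin≡ le≤le) = refl

fin⊑le : ∀ {s c d} → c ℤ.≤ d → fin s c ⊑ fin le d
fin⊑le {s} {c} {d} c≤d with ℤP.<-cmp c d
... | tri< c<d _ _  = fin< c<d
... | tri> _ _ d<c  = ⊥-elim (ℤP.<⇒≱ d<c c≤d)
fin⊑le {lt} _ | tri≈ _ refl _ = fin≡ lt≤ˢ
fin⊑le {le} _ | tri≈ _ refl _ = fin≡ le≤le

lt⊑fin : ∀ {t c d} → c ℤ.≤ d → fin lt c ⊑ fin t d
lt⊑fin {t} {c} {d} c≤d with ℤP.<-cmp c d
... | tri< c<d _ _  = fin< c<d
... | tri≈ _ refl _ = fin≡ lt≤ˢ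
... | tri> _ _ d<c  = ⊥-elim (ℤP.<⇒≱ d<c c≤d)

fin⊑fin⇒≤ : ∀ {s c t d} → fin s c ⊑ fin t d → c ℤ.≤ d
fin⊑fin⇒≤ (fin< c<d) = ℤP.<⇒≤ c<d
fin⊑fin⇒≤ (fin≡ _)   = ℤP.≤-refl

le⊑lt⇒< : ∀ {c d} → fin le c ⊑ fin lt d → c ℤ.< d
le⊑lt⇒< (fin< c<d) = c<d

<w-le⇒⊑-lt : ∀ {a c} → a <w fin le c → a ⊑ fin lt c
<w-le⇒⊑-lt { -∞}     _ = -∞⊑
<w-le⇒⊑-lt {fin s d} {c} a<c with ℤP.<-cmp d c
... | tri< d<c _ _ = fin< d<c
... | tri> _ _ c<d = ⊥-elim (<w⇒⋢ {fin s d} a<c (fin< c<d))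
<w-le⇒⊑-lt {fin lt d} _   | tri≈ _ refl _ = ⊑-refl
<w-le⇒⊑-lt {fin le d} a<c | tri≈ _ refl _ = ⊥-elim (<w⇒⋢ {fin le d} a<c ⊑-refl)

maxw-sel : ∀ a b → maxw a b ≡ a ⊎ maxw a b ≡ b
maxw-sel a b with a <ᵇ b
... | true  = inj₂ refl
... | false = inj₁ refl

maxw-≡ˡ : ∀ {a b} → b ⊑ a → maxw a b ≡ a
maxw-≡ˡ {a} {b} b⊑a with a <ᵇ b in eq
... | false = refl
... | true  = ⊥-elim (<w⇒⋢ {a} {b} (subst T (sym eq) tt) b⊑a)

maxw-≡ʳ : ∀ {a b} → a ⊑ b → maxw a b ≡ b
maxw-≡ʳ {a} {b} a⊑b with a <ᵇ b in eq
... | true  = refl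
... | false = ⊑-antisym a⊑b (≤w⇒⊑ {b} {a} (subst (λ z → T (not z)) (sym eq) tt))

_⊓ˢ_ : Strict → Strict → Strict
le ⊓ˢ le = le
_  ⊓ˢ _  = lt

+w-fin : ∀ s c t d → fin s c +w fin t d ≡ fin (s ⊓ˢ t) (c ℤ.+ d)
+w-fin lt c lt d = refl
+w-fin lt c le d = refl
+w-fin le c lt d = refl
+w-fin le c le d = refl

⊓ˢ-assoc : ∀ r s t → (r ⊓ˢ s) ⊓ˢ t ≡ r ⊓ˢ (s ⊓ˢ t)
⊓ˢ-assoc lt s  t  = refl
⊓ˢ-assoc le lt t  = refl
⊓ˢ-assoc le le lt = refl
⊓ˢ-assoc le le le = refl

⊓ˢ-monoˡ : ∀ {s s'} t → s ≤ˢ s' → s ⊓ˢ t ≤ˢ s' ⊓ˢ t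
⊓ˢ-monoˡ t  lt≤ˢ  = lt≤ˢ
⊓ˢ-monoˡ lt le≤le = lt≤ˢ
⊓ˢ-monoˡ le le≤le = le≤le

⊓ˢ-monoʳ : ∀ s {t t'} → t ≤ˢ t' → s ⊓ˢ t ≤ˢ s ⊓ˢ t'
⊓ˢ-monoʳ lt _     = lt≤ˢ
⊓ˢ-monoʳ le lt≤ˢ  = lt≤ˢ
⊓ˢ-monoʳ le le≤le = le≤le

+w-assoc : ∀ a b c → (a +w b) +w c ≡ a +w (b +w c)
+w-assoc -∞ _ _ = refl
+w-assoc ∞ -∞ _ = refl
+w-assoc ∞ ∞ -∞ = refl
+w-assoc ∞ ∞ ∞ = refl
+w-assoc ∞ ∞ (fin _ _) = refl
+w-assoc ∞ (fin _ _) -∞ = refl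
+w-assoc ∞ (fin _ _) ∞ = refl
+w-assoc ∞ (fin _ _) (fin _ _) = refl
+w-assoc (fin _ _) -∞ _ = refl
+w-assoc (fin _ _) ∞ -∞ = refl
+w-assoc (fin _ _) ∞ ∞ = refl
+w-assoc (fin _ _) ∞ (fin _ _) = refl
+w-assoc (fin _ _) (fin _ _) -∞ = refl
+w-assoc (fin _ _) (fin _ _) ∞ = refl
+w-assoc (fin r c) (fin s d) (fin t e) = begin
  (fin r c +w fin s d) +w fin t e       ≡⟨ cong (_+w fin t e) (+w-fin r c s d) ⟩
  fin (r ⊓ˢ s) (c ℤ.+ d) +w fin t e     ≡⟨ +w-fin (r ⊓ˢ s) (c ℤ.+ d) t e ⟩
  fin ((r ⊓ˢ s) ⊓ˢ t) (c ℤ.+ d ℤ.+ e)   ≡⟨ cong₂ fin (⊓ˢ-assoc r s t) (ℤP.+-assoc c d e) ⟩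
  fin (r ⊓ˢ (s ⊓ˢ t)) (c ℤ.+ (d ℤ.+ e)) ≡⟨ sym (+w-fin r c (s ⊓ˢ t) (d ℤ.+ e)) ⟩
  fin r c +w fin (s ⊓ˢ t) (d ℤ.+ e)     ≡⟨ cong (fin r c +w_) (sym (+w-fin s d t e)) ⟩
  fin r c +w (fin s d +w fin t e)       ∎
  where open ≡-Reasoning

+w-identityˡ : ∀ a → fin le (+ 0) +w a ≡ a
+w-identityˡ -∞         = refl
+w-identityˡ ∞          = refl
+w-identityˡ (fin lt c) = cong (fin lt) (ℤP.+-identityˡ c)
+w-identityˡ (fin le c) = cong (fin le) (ℤP.+-identityˡ c)

+w-identityʳ : ∀ a → a +w fin le (+ 0) ≡ a
+w-identityʳ -∞         = refl
+w-identityʳ ∞          = refl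
+w-identityʳ (fin lt c) = cong (fin lt) (ℤP.+-identityʳ c)
+w-identityʳ (fin le c) = cong (fin le) (ℤP.+-identityʳ c)

+w-zeroʳ : ∀ a → a +w -∞ ≡ -∞
+w-zeroʳ -∞        = refl
+w-zeroʳ ∞         = refl
+w-zeroʳ (fin _ _) = refl

+w-monoˡ : ∀ {a a'} b → a ⊑ a' → a +w b ⊑ a' +w b
+w-monoˡ {a} -∞ _ rewrite +w-zeroʳ a = -∞⊑
+w-monoˡ _         -∞⊑      = -∞⊑
+w-monoˡ ∞         ⊑∞       = ⊑∞
+w-monoˡ (fin _ _) ⊑∞       = ⊑∞
+w-monoˡ ∞         (fin< _) = ⊑∞
+w-monoˡ ∞         (fin≡ _) = ⊑∞
+w-monoˡ (fin t e) (fin< {s} {s'} {c} {d} c<d)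
  rewrite +w-fin s c t e | +w-fin s' d t e = fin< (ℤP.+-monoˡ-< e c<d)
+w-monoˡ (fin t e) (fin≡ {s} {s'} {c} s≤s')
  rewrite +w-fin s c t e | +w-fin s' c t e = fin≡ (⊓ˢ-monoˡ t s≤s')

+w-monoʳ : ∀ a {b b'} → b ⊑ b' → a +w b ⊑ a +w b'
+w-monoʳ -∞        _        = -∞⊑
+w-monoʳ a         -∞⊑      rewrite +w-zeroʳ a = -∞⊑
+w-monoʳ ∞         ⊑∞       = ⊑∞
+w-monoʳ (fin _ _) ⊑∞       = ⊑∞
+w-monoʳ ∞         (fin< _) = ⊑∞
+w-monoʳ ∞         (fin≡ _) = ⊑∞
+w-monoʳ (fin s c) (fin< {t} {t'} {d} {e} d<e)
  rewrite +w-fin s c t d | +w-fin s c t' e = fin< (ℤP.+-monoʳ-< c d<e)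
+w-monoʳ (fin s c) (fin≡ {t} {t'} {d} t≤t')
  rewrite +w-fin s c t d | +w-fin s c t' d = fin≡ (⊓ˢ-monoʳ s t≤t')

+w-∞ : ∀ a → ¬ a ≡ -∞ → a +w ∞ ≡ ∞
+w-∞ -∞        a≢-∞ = ⊥-elim (a≢-∞ refl)
+w-∞ ∞         _    = refl
+w-∞ (fin _ _) _    = refl

∞-+w : ∀ a → ¬ a ≡ -∞ → ∞ +w a ≡ ∞
∞-+w -∞        a≢-∞ = ⊥-elim (a≢-∞ refl)
∞-+w ∞         _    = refl
∞-+w (fin _ _) _    = refl

-- Integers in ℚ

infix 8 _/1+_

_/1+_ : ℤ → ℕ → ℚ
a /1+ m = a / suc m

/1+-toℚᵘ : ∀ a m → ℚ.toℚᵘ (a /1+ m) ℚᵘ.≃ mkℚᵘ a m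
/1+-toℚᵘ a m = ℚP.toℚᵘ-fromℚᵘ (mkℚᵘ a m)

/1+-mono-≤ : ∀ m {a b} → a ℤ.≤ b → a /1+ m ℚ.≤ b /1+ m
/1+-mono-≤ m {a} {b} a≤b = ℚP.toℚᵘ-cancel-≤
  (ℚᵘP.≤-respˡ-≃ (ℚᵘP.≃-sym (/1+-toℚᵘ a m)) (ℚᵘP.≤-respʳ-≃ (ℚᵘP.≃-sym (/1+-toℚᵘ b m))
    (*≤* (ℤP.*-monoʳ-≤-nonNeg (+ suc m) a≤b))))

/1+-mono-< : ∀ m {a b} → a ℤ.< b → a /1+ m ℚ.< b /1+ m
/1+-mono-< m {a} {b} a<b = ℚP.toℚᵘ-cancel-<
  (ℚᵘP.<-respˡ-≃ (ℚᵘP.≃-sym (/1+-toℚᵘ a m)) (ℚᵘP.<-respʳ-≃ (ℚᵘP.≃-sym (/1+-toℚᵘ b m))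
    (*<* (ℤP.*-monoʳ-<-pos (+ suc m) a<b))))

/1+-+ : ∀ m a b → (a ℤ.+ b) /1+ m ≡ a /1+ m ℚ.+ b /1+ m
/1+-+ m a b = ℚP.toℚᵘ-injective (ℚᵘP.≃-trans (/1+-toℚᵘ (a ℤ.+ b) m)
  (ℚᵘP.≃-sym (ℚᵘP.≃-trans (ℚP.toℚᵘ-homo-+ (a /1+ m) (b /1+ m))
    (ℚᵘP.≃-trans (ℚᵘP.+-cong (/1+-toℚᵘ a m) (/1+-toℚᵘ b m)) (*≡* cross-multiplied)))))
  where
  cross-multiplied : (a ℤ.* + suc m ℤ.+ b ℤ.* + suc m) ℤ.* + suc m ≡ (a ℤ.+ b) ℤ.* + (suc m ℕ.* suc m)
  cross-multiplied rewrite ℤP.pos-* (suc m) (suc m) = ring a b (+ suc m)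
    where
    ring : ∀ a b d → (a ℤ.* d ℤ.+ b ℤ.* d) ℤ.* d ≡ (a ℤ.+ b) ℤ.* (d ℤ.* d)
    ring = solve-∀

/1+-neg : ∀ m a → (- a) /1+ m ≡ ℚ.- (a /1+ m)
/1+-neg m a = ℚP.toℚᵘ-injective (ℚᵘP.≃-trans (/1+-toℚᵘ (- a) m)
  (ℚᵘP.≃-sym (ℚᵘP.≃-trans (ℚP.toℚᵘ-homo‿- (a /1+ m)) (ℚᵘP.-‿cong (/1+-toℚᵘ a m)))))

/1+-- : ∀ m a b → (a ℤ.- b) /1+ m ≡ a /1+ m ℚ.- b /1+ m
/1+-- m a b = trans (/1+-+ m a (- b)) (cong (a /1+ m ℚ.+_) (/1+-neg m b))

toℚ≡*/1+ : ∀ m c → toℚ c ≡ (+ suc m ℤ.* c) /1+ m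
toℚ≡*/1+ m c = ℚP.toℚᵘ-injective (ℚᵘP.≃-trans (/1+-toℚᵘ c 0)
  (ℚᵘP.≃-sym (ℚᵘP.≃-trans (/1+-toℚᵘ (+ suc m ℤ.* c) m) (*≡* (ring (+ suc m) c)))))
  where
  ring : ∀ d c → d ℤ.* c ℤ.* + 1 ≡ c ℤ.* d
  ring = solve-∀

toℚ-mono-≤ : ∀ {a b} → a ℤ.≤ b → toℚ a ℚ.≤ toℚ b
toℚ-mono-≤ = /1+-mono-≤ 0

toℚ-mono-< : ∀ {a b} → a ℤ.< b → toℚ a ℚ.< toℚ b
toℚ-mono-< = /1+-mono-< 0

toℚ-cancel-≤ : ∀ a b → toℚ a ℚ.≤ toℚ b → a ℤ.≤ b
toℚ-cancel-≤ a b p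
  with ℚᵘP.≤-respˡ-≃ (/1+-toℚᵘ a 0) (ℚᵘP.≤-respʳ-≃ (/1+-toℚᵘ b 0) (ℚP.toℚᵘ-mono-≤ p))
... | *≤* q = ℤP.*-cancelʳ-≤-pos a b (+ 1) q

toℚ-cancel-< : ∀ a b → toℚ a ℚ.< toℚ b → a ℤ.< b
toℚ-cancel-< a b p
  with ℚᵘP.<-respˡ-≃ (/1+-toℚᵘ a 0) (ℚᵘP.<-respʳ-≃ (/1+-toℚᵘ b 0) (ℚP.toℚᵘ-mono-< p))
... | *<* q = subst₂ ℤ._<_ (ℤP.*-identityʳ a) (ℤP.*-identityʳ b) q

toℚ-injective : ∀ {a b} → toℚ a ≡ toℚ b → a ≡ b
toℚ-injective {a} {b} e =
  ℤP.≤-antisym (toℚ-cancel-≤ a b (ℚP.≤-reflexive e)) (toℚ-cancel-≤ b a (ℚP.≤-reflexive (sym e)))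

toℚ-+ : ∀ a b → toℚ (a ℤ.+ b) ≡ toℚ a ℚ.+ toℚ b
toℚ-+ = /1+-+ 0

i<j⇒i+1≤j : ∀ {i j} → i ℤ.< j → i ℤ.+ ℤ.1ℤ ℤ.≤ j
i<j⇒i+1≤j {i} {j} i<j = subst (ℤ._≤ j) (ℤP.+-comm ℤ.1ℤ i) (ℤP.i<j⇒suc[i]≤j i<j)

i-1<j⇒i≤j : ∀ {i j} → i ℤ.- ℤ.1ℤ ℤ.< j → i ℤ.≤ j
i-1<j⇒i≤j {i} {j} i-1<j = subst (ℤ._≤ j) (ring i) (i<j⇒i+1≤j i-1<j)
  where
  ring : ∀ i → i ℤ.- ℤ.1ℤ ℤ.+ ℤ.1ℤ ≡ i
  ring = solve-∀

i<j⇒i≤j-1 : ∀ {i j} → i ℤ.< j → i ℤ.≤ j ℤ.- ℤ.1ℤ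
i<j⇒i≤j-1 {i} {j} i<j = subst (ℤ._≤ j ℤ.- ℤ.1ℤ) (ring i) (ℤP.+-monoˡ-≤ (- ℤ.1ℤ) (i<j⇒i+1≤j i<j))
  where
  ring : ∀ i → i ℤ.+ ℤ.1ℤ ℤ.- ℤ.1ℤ ≡ i
  ring = solve-∀

i<j⇒1-j≤-i : ∀ {i j} → i ℤ.< j → - j ℤ.+ ℤ.1ℤ ℤ.≤ - i
i<j⇒1-j≤-i {i} {j} i<j =
  subst₂ ℤ._≤_ (ring₁ i j) (ring₂ i j) (ℤP.+-monoʳ-≤ (- j ℤ.- i) (i<j⇒i+1≤j i<j))
  where
  ring₁ : ∀ i j → (- j ℤ.- i) ℤ.+ (i ℤ.+ ℤ.1ℤ) ≡ - j ℤ.+ ℤ.1ℤ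
  ring₁ = solve-∀
  ring₂ : ∀ i j → (- j ℤ.- i) ℤ.+ j ≡ - i
  ring₂ = solve-∀

i-1<i : ∀ i → i ℤ.- ℤ.1ℤ ℤ.< i
i-1<i i = subst (i ℤ.- ℤ.1ℤ ℤ.<_) (ℤP.+-identityʳ i) (ℤP.+-monoʳ-< i { - ℤ.1ℤ} {+ 0} ℤ.-<+)

0-q≤d⇒-d≤q : ∀ {q} d → ℚ.0ℚ ℚ.- q ℚ.≤ toℚ d → toℚ (- d) ℚ.≤ q
0-q≤d⇒-d≤q {q} d h rewrite ℚP.+-identityˡ (ℚ.- q) | /1+-neg 0 d =
  subst (ℚ.- toℚ d ℚ.≤_) (ℚ-neg-involutive q) (ℚP.neg-antimono-≤ h)

0-q<d⇒-d<q : ∀ {q} d → ℚ.0ℚ ℚ.- q ℚ.< toℚ d → toℚ (- d) ℚ.< q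
0-q<d⇒-d<q {q} d h rewrite ℚP.+-identityˡ (ℚ.- q) | /1+-neg 0 d =
  subst (ℚ.- toℚ d ℚ.<_) (ℚ-neg-involutive q) (ℚP.neg-antimono-< h)

q≤p+q : ∀ {p q} → ℚ.0ℚ ℚ.≤ p → q ℚ.≤ p ℚ.+ q
q≤p+q {p} {q} 0≤p = subst (ℚ._≤ p ℚ.+ q) (ℚP.+-identityˡ q) (ℚP.+-monoˡ-≤ q 0≤p)

-- Satisfaction along paths

SatW-+w : ∀ {p q} a b → SatW p a → SatW q b → SatW (p ℚ.+ q) (a +w b)
SatW-+w -∞         _          ()
SatW-+w ∞          -∞         _ ()
SatW-+w ∞          ∞          _ _ = tt
SatW-+w ∞          (fin _ _)  _ _ = tt
SatW-+w (fin _ _)  -∞         _ ()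
SatW-+w (fin _ _)  ∞          _ _ = tt
SatW-+w (fin lt c) (fin lt d) p q rewrite toℚ-+ c d = ℚP.+-mono-< p q
SatW-+w (fin lt c) (fin le d) p q rewrite toℚ-+ c d = ℚP.+-mono-<-≤ p q
SatW-+w (fin le c) (fin lt d) p q rewrite toℚ-+ c d = ℚP.+-mono-≤-< p q
SatW-+w (fin le c) (fin le d) p q rewrite toℚ-+ c d = ℚP.+-mono-≤ p q

SatW-antitone : ∀ {p q} w → p ℚ.≤ q → SatW q w → SatW p w
SatW-antitone -∞         _   ()
SatW-antitone ∞          _   _ = tt
SatW-antitone (fin lt c) p≤q q<c = ℚP.≤-<-trans p≤q q<c
SatW-antitone (fin le c) p≤q q≤c = ℚP.≤-trans p≤q q≤c

SatW-⊑ : ∀ {p a b} → SatW p a → a ⊑ b → SatW p b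
SatW-⊑ ()  -∞⊑
SatW-⊑ _   ⊑∞ = tt
SatW-⊑ {a = fin lt c} {fin lt d} p<c (fin< c<d) = ℚP.<-trans p<c (toℚ-mono-< c<d)
SatW-⊑ {a = fin lt c} {fin le d} p<c (fin< c<d) = ℚP.<⇒≤ (ℚP.<-trans p<c (toℚ-mono-< c<d))
SatW-⊑ {a = fin le c} {fin lt d} p≤c (fin< c<d) = ℚP.≤-<-trans p≤c (toℚ-mono-< c<d)
SatW-⊑ {a = fin le c} {fin le d} p≤c (fin< c<d) = ℚP.<⇒≤ (ℚP.≤-<-trans p≤c (toℚ-mono-< c<d))
SatW-⊑ {a = fin lt c} {fin lt c} p<c (fin≡ lt≤ˢ)  = p<c
SatW-⊑ {a = fin lt c} {fin le c} p<c (fin≡ lt≤ˢ)  = ℚP.<⇒≤ p<c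
SatW-⊑ p≤c (fin≡ le≤le) = p≤c

leastPath-unique : ∀ {n} {G : DistGraph n} {i j w w'} →
                   LeastPath G i j w → LeastPath G i j w' → w ≡ w'
leastPath-unique ((ks , refl) , least) ((ks' , refl) , least') =
  ⊑-antisym (≤w⇒⊑ (least ks')) (≤w⇒⊑ (least' ks))

module _ {n : ℕ} {G : DistGraph n} {v : Valuation n} (v∈G : v ∈⟦ G ⟧) where

  pathWeight-sound : ∀ i ks j → SatW (val v j ℚ.- val v i) (pathWeight G i ks j)
  pathWeight-sound i []       j = proj₂ v∈G i j
  pathWeight-sound i (k ∷ ks) j =
    subst (λ q → SatW q (pathWeight G i (k ∷ ks) j)) (telescope (val v i) (val v k) (val v j))
      (SatW-+w (G i k) (pathWeight G k ks j) (proj₂ v∈G i k) (pathWeight-sound k ks j))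
    where
    open +-*-Solver
    telescope : ∀ p q r → (q ℚ.- p) ℚ.+ (r ℚ.- q) ≡ r ℚ.- p
    telescope = solve 3 (λ p q r → (q :- p) :+ (r :- q) := r :- p) refl

  leastPath-sound : ∀ {i j w} → LeastPath G i j w → SatW (val v j ℚ.- val v i) w
  leastPath-sound ((ks , refl) , _) = pathWeight-sound _ ks _

-- Region graphs

module _ {n : ℕ} {α : Fin n → ℕ} (R : Region α) where

  private
    RG : DistGraph n
    RG = regionGraph α R

    IsOpen : Fin n → Set
    IsOpen x = T (isOpen (con R x))

    isOpen? : ∀ x → IsOpen x ⊎ ¬ IsOpen x
    isOpen? x with isOpen (con R x)
    ... | true  = inj₁ tt
    ... | false = inj₂ λ ()

  regionGraph-refl : ∀ x → RG (fsuc x) (fsuc x) ≡ fin le (+ 0)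
  regionGraph-refl x with toℕ x ℕ.≟ toℕ x
  ... | yes _   = refl
  ... | no x≢x = ⊥-elim (x≢x refl)

  regionGraph-open-open : ∀ x y → x ≢ y → IsOpen x → IsOpen y →
                          fin lt (upper (con R x) ℤ.- upper (con R y)) ⊑ RG (fsuc y) (fsuc x)
  regionGraph-open-open x y x≢y ox oy with toℕ x ℕ.≟ toℕ y
  ... | yes e = ⊥-elim (x≢y (FinP.toℕ-injective e))
  ... | no _ with isOpen (con R x) | ox | isOpen (con R y) | oy
  ... | true | _ | true | _ with (if toℕ x ℕ.<ᵇ toℕ y then ord R x y else flipC (ord R y x))
  ... | lessF    = ⊑-refl
  ... | equalF   = fin≡ lt≤ˢ
  ... | greaterF = ⊑∞

  regionGraph-not-open : ∀ x y → x ≢ y → ¬ (IsOpen x × IsOpen y) → RG (fsuc y) (fsuc x) ≡ ∞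
  regionGraph-not-open x y x≢y ¬open with toℕ x ℕ.≟ toℕ y
  ... | yes e = ⊥-elim (x≢y (FinP.toℕ-injective e))
  ... | no _ with isOpen (con R x) | isOpen (con R y)
  ... | true  | true  = ⊥-elim (¬open (tt , tt))
  ... | true  | false = refl
  ... | false | _     = refl

  regionGraph-0x-open : ∀ x → IsOpen x → RG fzero (fsuc x) ≡ fin lt (upper (con R x))
  regionGraph-0x-open x _ with con R x
  ... | btw _ _ _ = refl

  regionGraph-x0-open : ∀ x → IsOpen x → RG (fsuc x) fzero ≡ fin lt (- (upper (con R x) ℤ.- ℤ.1ℤ))
  regionGraph-x0-open x _ with con R x
  ... | btw _ _ _ = refl

  regionGraph-0x≢-∞ : ∀ x → ¬ RG fzero (fsuc x) ≡ -∞
  regionGraph-0x≢-∞ x with con R x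
  ... | eqc _ _   = λ ()
  ... | btw _ _ _ = λ ()
  ... | gtc       = λ ()

  regionGraph-x0≢-∞ : ∀ x → ¬ RG (fsuc x) fzero ≡ -∞
  regionGraph-x0≢-∞ x with con R x
  ... | eqc _ _   = λ ()
  ... | btw _ _ _ = λ ()
  ... | gtc       = λ ()

  regionGraph-cycle-0x0 : ∀ x → fin le (+ 0) ⊑ RG fzero (fsuc x) +w RG (fsuc x) fzero
  regionGraph-cycle-0x0 x with con R x
  ... | eqc c _   = fin⊑le (ℤP.≤-reflexive (sym (ℤP.+-inverseʳ (+ c))))
  ... | btw c _ _ = fin< (subst (+ 0 ℤ.<_) (sym (ring (+ c))) (ℤ.+<+ (ℕ.s≤s ℕ.z≤n)))
    where
    ring : ∀ c → c ℤ.+ - (c ℤ.- ℤ.1ℤ) ≡ ℤ.1ℤ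
    ring = solve-∀
  ... | gtc       = ⊑∞

  regionGraph-triangle₀ : ∀ i k → RG fzero k ⊑ RG fzero i +w RG i k
  regionGraph-triangle₀ fzero    k        = ⊑-reflexive (sym (+w-identityˡ (RG fzero k)))
  regionGraph-triangle₀ (fsuc y) fzero    = regionGraph-cycle-0x0 y
  regionGraph-triangle₀ (fsuc y) (fsuc x) with x Fin.≟ y
  ... | yes refl rewrite regionGraph-refl x = ⊑-reflexive (sym (+w-identityʳ (RG fzero (fsuc x))))
  ... | no x≢y with isOpen? x | isOpen? y
  ... | inj₁ ox | inj₁ oy rewrite regionGraph-0x-open x ox | regionGraph-0x-open y oy =
    ⊑-trans (⊑-reflexive (cong (fin lt) (sym (ring (upper (con R x)) (upper (con R y))))))
            (+w-monoʳ (fin lt (upper (con R y))) (regionGraph-open-open x y x≢y ox oy))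
    where
    ring : ∀ a b → b ℤ.+ (a ℤ.- b) ≡ a
    ring = solve-∀
  ... | inj₁ ox  | inj₂ ¬oy rewrite regionGraph-not-open x y x≢y (¬oy ∘ proj₂) =
    ⊑-trans ⊑∞ (⊑-reflexive (sym (+w-∞ _ (regionGraph-0x≢-∞ y))))
  ... | inj₂ ¬ox | _        rewrite regionGraph-not-open x y x≢y (¬ox ∘ proj₁) =
    ⊑-trans ⊑∞ (⊑-reflexive (sym (+w-∞ _ (regionGraph-0x≢-∞ y))))

  regionGraph-triangle⁰ : ∀ i k → RG i fzero ⊑ RG i k +w RG k fzero
  regionGraph-triangle⁰ i        fzero    = ⊑-reflexive (sym (+w-identityʳ (RG i fzero)))
  regionGraph-triangle⁰ fzero    (fsuc x) = regionGraph-cycle-0x0 x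
  regionGraph-triangle⁰ (fsuc y) (fsuc x) with x Fin.≟ y
  ... | yes refl rewrite regionGraph-refl x = ⊑-reflexive (sym (+w-identityˡ (RG (fsuc x) fzero)))
  ... | no x≢y with isOpen? x | isOpen? y
  ... | inj₁ ox | inj₁ oy rewrite regionGraph-x0-open x ox | regionGraph-x0-open y oy =
    ⊑-trans (⊑-reflexive (cong (fin lt) (sym (ring (upper (con R x)) (upper (con R y))))))
            (+w-monoˡ (fin lt (- (upper (con R x) ℤ.- ℤ.1ℤ))) (regionGraph-open-open x y x≢y ox oy))
    where
    ring : ∀ a b → (a ℤ.- b) ℤ.+ - (a ℤ.- ℤ.1ℤ) ≡ - (b ℤ.- ℤ.1ℤ)
    ring = solve-∀
  ... | inj₁ ox  | inj₂ ¬oy rewrite regionGraph-not-open x y x≢y (¬oy ∘ proj₂) =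
    ⊑-trans ⊑∞ (⊑-reflexive (sym (∞-+w _ (regionGraph-x0≢-∞ x))))
  ... | inj₂ ¬ox | _        rewrite regionGraph-not-open x y x≢y (¬ox ∘ proj₁) =
    ⊑-trans ⊑∞ (⊑-reflexive (sym (∞-+w _ (regionGraph-x0≢-∞ x))))

  pathWeight-triangle₀ : ∀ i ks j → RG fzero j ⊑ RG fzero i +w pathWeight RG i ks j
  pathWeight-triangle₀ i []       j = regionGraph-triangle₀ i j
  pathWeight-triangle₀ i (k ∷ ks) j =
    ⊑-trans (pathWeight-triangle₀ k ks j)
      (⊑-trans (+w-monoˡ (pathWeight RG k ks j) (regionGraph-triangle₀ i k))
               (⊑-reflexive (+w-assoc (RG fzero i) (RG i k) (pathWeight RG k ks j))))

  pathWeight-triangle⁰ : ∀ i ks j → RG i fzero ⊑ pathWeight RG i ks j +w RG j fzero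
  pathWeight-triangle⁰ i []       j = regionGraph-triangle⁰ i j
  pathWeight-triangle⁰ i (k ∷ ks) j =
    ⊑-trans (regionGraph-triangle⁰ i k)
      (⊑-trans (+w-monoʳ (RG i k) (pathWeight-triangle⁰ k ks j))
               (⊑-reflexive (sym (+w-assoc (RG i k) (pathWeight RG k ks j) (RG j fzero)))))

  regionGraph-least-from0 : ∀ j → LeastPath RG fzero j (RG fzero j)
  regionGraph-least-from0 j = ([] , refl) , λ ks → ⊑⇒≤w
    (subst (RG fzero j ⊑_) (+w-identityˡ _) (pathWeight-triangle₀ fzero ks j))

  regionGraph-least-to0 : ∀ i → LeastPath RG i fzero (RG i fzero)
  regionGraph-least-to0 i = ([] , refl) , λ ks → ⊑⇒≤w
    (subst (RG i fzero ⊑_) (+w-identityʳ _) (pathWeight-triangle⁰ i ks fzero))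

module _ {n : ℕ} {α : Fin n → ℕ} (R : Region α) (x : Fin n) {q : ℚ} where

  private
    RG : DistGraph n
    RG = regionGraph α R

  regionGraph-at-integer : SatClock (con R x) q → ∀ k → q ≡ toℚ k → k ℤ.≤ + α x →
                           RG fzero (fsuc x) ≡ fin le k × RG (fsuc x) fzero ≡ fin le (- k)
  regionGraph-at-integer sat k q≡k k≤α with con R x | sat
  ... | eqc c _   | q≡c       = cong (fin le) c≡k , cong (λ z → fin le (- z)) c≡k
    where
    c≡k : + c ≡ k
    c≡k = toℚ-injective (trans (sym q≡c) q≡k)
  ... | btw c _ _ | (lo , hi) = ⊥-elim (ℤP.<⇒≱ k<c (i-1<j⇒i≤j c-1<k))
    where
    k<c : k ℤ.< + c
    k<c = toℚ-cancel-< k (+ c) (subst (ℚ._< _) q≡k hi)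
    c-1<k : + c ℤ.- ℤ.1ℤ ℤ.< k
    c-1<k = toℚ-cancel-< (+ c ℤ.- ℤ.1ℤ) k (subst (_ ℚ.<_) q≡k lo)
  ... | gtc       | α<q       = ⊥-elim (ℤP.<⇒≱ (toℚ-cancel-< (+ α x) k (subst (_ ℚ.<_) q≡k α<q)) k≤α)

  regionGraph-between : SatClock (con R x) q → ∀ c → toℚ (c ℤ.- ℤ.1ℤ) ℚ.< q → q ℚ.< toℚ c →
                        c ℤ.≤ + α x →
                        RG fzero (fsuc x) ≡ fin lt c × RG (fsuc x) fzero ≡ fin lt (- (c ℤ.- ℤ.1ℤ))
  regionGraph-between sat c c-1<q q<c c≤α with con R x | sat
  ... | eqc c' _   | q≡c'        = ⊥-elim (ℤP.<⇒≱ c'<c (i-1<j⇒i≤j c-1<c'))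
    where
    c'<c : + c' ℤ.< c
    c'<c = toℚ-cancel-< (+ c') c (subst (ℚ._< _) q≡c' q<c)
    c-1<c' : c ℤ.- ℤ.1ℤ ℤ.< + c'
    c-1<c' = toℚ-cancel-< (c ℤ.- ℤ.1ℤ) (+ c') (subst (_ ℚ.<_) q≡c' c-1<q)
  ... | btw c' _ _ | (c'-1<q , q<c') = cong (fin lt) c'≡c , cong (λ z → fin lt (- (z ℤ.- ℤ.1ℤ))) c'≡c
    where
    c'≡c : + c' ≡ c
    c'≡c = ℤP.≤-antisym (i-1<j⇒i≤j (toℚ-cancel-< (+ c' ℤ.- ℤ.1ℤ) c (ℚP.<-trans c'-1<q q<c)))
                        (i-1<j⇒i≤j (toℚ-cancel-< (c ℤ.- ℤ.1ℤ) (+ c') (ℚP.<-trans c-1<q q<c')))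
  ... | gtc        | α<q         = ⊥-elim (ℤP.<⇒≱ (toℚ-cancel-< (+ α x) c (ℚP.<-trans α<q q<c)) c≤α)

  regionGraph-above : SatClock (con R x) q → toℚ (+ α x) ℚ.< q →
                      RG fzero (fsuc x) ≡ ∞ × RG (fsuc x) fzero ≡ fin lt (- (+ α x))
  regionGraph-above sat α<q with con R x | sat
  ... | eqc c c≤α   | q≡c      =
    ⊥-elim (ℤP.<⇒≱ (toℚ-cancel-< (+ α x) (+ c) (subst (_ ℚ.<_) q≡c α<q)) (ℤ.+≤+ c≤α))
  ... | btw c _ c≤α | (_ , hi) =
    ⊥-elim (ℤP.<⇒≱ (toℚ-cancel-< (+ α x) (+ c) (ℚP.<-trans α<q hi)) (ℤ.+≤+ c≤α))
  ... | gtc         | _        = refl , refl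

  regionGraph-0x-lower : SatClock (con R x) q → ∀ Z → SatW (ℚ.0ℚ ℚ.- q) Z →
                         ceilw (negw Z) ⊑ RG fzero (fsuc x)
  regionGraph-0x-lower _ ∞ _ = -∞⊑
  regionGraph-0x-lower sat (fin s d) -q≼d with con R x | sat
  regionGraph-0x-lower sat (fin le d) -q≤d | eqc c _   | q≡c     =
    fin⊑le (toℚ-cancel-≤ (- d) (+ c) (subst (_ ℚ.≤_) q≡c (0-q≤d⇒-d≤q d -q≤d)))
  regionGraph-0x-lower sat (fin le d) -q≤d | btw c _ _ | (_ , hi) =
    fin< (toℚ-cancel-< (- d) (+ c) (ℚP.≤-<-trans (0-q≤d⇒-d≤q d -q≤d) hi))
  regionGraph-0x-lower sat (fin lt d) -q<d | eqc c _   | q≡c     =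
    lt⊑fin (i<j⇒i+1≤j (toℚ-cancel-< (- d) (+ c) (subst (_ ℚ.<_) q≡c (0-q<d⇒-d<q d -q<d))))
  regionGraph-0x-lower sat (fin lt d) -q<d | btw c _ _ | (_ , hi) =
    lt⊑fin (i<j⇒i+1≤j (toℚ-cancel-< (- d) (+ c) (ℚP.<-trans (0-q<d⇒-d<q d -q<d) hi)))
  regionGraph-0x-lower sat (fin s d) _ | gtc       | _       = ⊑∞

  regionGraph-x0-lower : SatClock (con R x) q → ∀ Z → SatW (q ℚ.- ℚ.0ℚ) Z →
                         ceilw (negw Z) ⊑ RG (fsuc x) fzero
  regionGraph-x0-lower _ ∞ _ = -∞⊑
  regionGraph-x0-lower sat (fin s d) q≼d
    with con R x | sat | subst (λ p → SatW p (fin s d)) (ℚP.+-identityʳ q) q≼d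
  regionGraph-x0-lower sat (fin le d) _ | eqc c _   | q≡c       | q≤d =
    fin⊑le (ℤP.neg-mono-≤ (toℚ-cancel-≤ (+ c) d (subst (ℚ._≤ _) q≡c q≤d)))
  regionGraph-x0-lower sat (fin le d) _ | btw c _ _ | (lo , _)  | q≤d =
    fin< (ℤP.neg-mono-< (toℚ-cancel-< (+ c ℤ.- ℤ.1ℤ) d (ℚP.<-≤-trans lo q≤d)))
  regionGraph-x0-lower sat (fin le d) _ | gtc       | α<q       | q≤d =
    fin< (ℤP.neg-mono-< (toℚ-cancel-< (+ α x) d (ℚP.<-≤-trans α<q q≤d)))
  regionGraph-x0-lower sat (fin lt d) _ | eqc c _   | q≡c       | q<d =
    lt⊑fin (i<j⇒1-j≤-i (toℚ-cancel-< (+ c) d (subst (ℚ._< _) q≡c q<d)))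
  regionGraph-x0-lower sat (fin lt d) _ | btw c _ _ | (lo , _)  | q<d =
    lt⊑fin (i<j⇒1-j≤-i (toℚ-cancel-< (+ c ℤ.- ℤ.1ℤ) d (ℚP.<-trans lo q<d)))
  regionGraph-x0-lower sat (fin lt d) _ | gtc       | α<q       | q<d =
    lt⊑fin (i<j⇒1-j≤-i (toℚ-cancel-< (+ α x) d (ℚP.<-trans α<q q<d)))

regionGraph-x0-bound : ∀ {n} {α : Fin n → ℕ} (R : Region α) x →
                       fin lt (- (+ α x)) ⊑ regionGraph α R (fsuc x) fzero
regionGraph-x0-bound R x with con R x
... | eqc c c≤α   = lt⊑fin (ℤP.neg-mono-≤ (ℤ.+≤+ c≤α))
... | btw c _ c≤α = lt⊑fin (ℤP.neg-mono-≤ (ℤP.≤-trans (ℤP.<⇒≤ (i-1<i (+ c))) (ℤ.+≤+ c≤α)))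
... | gtc         = ⊑-refl

clockConstraint : ∀ a q → ℚ.0ℚ ℚ.≤ q → ∃ λ (c : ClockCon a) → SatClock c q
clockConstraint a q 0≤q = scan 0 a refl (ℚP.<-≤-trans (toℚ-mono-< { - ℤ.1ℤ} {+ 0} ℤ.-<+) 0≤q)
  where
  scan : ∀ k r → k ℕ.+ r ≡ a → toℚ (+ k ℤ.- ℤ.1ℤ) ℚ.< q → ∃ λ (c : ClockCon a) → SatClock c q
  scan k r k+r≡a k-1<q with ℚP.<-cmp q (toℚ (+ k))
  ... | tri≈ _ q≡k _ = eqc k (subst (k ℕ.≤_) k+r≡a (ℕP.m≤m+n k r)) , q≡k
  scan zero    r       _      _    | tri< q<0 _ _ = ⊥-elim (ℚP.<-irrefl refl (ℚP.≤-<-trans 0≤q q<0))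
  scan (suc k) r       k+r≡a  k<q  | tri< q<k _ _ =
    btw (suc k) (ℕ.s≤s ℕ.z≤n) (subst (suc k ℕ.≤_) k+r≡a (ℕP.m≤m+n (suc k) r)) , k<q , q<k
  scan k       zero    k+0≡a  _    | tri> _ _ k<q =
    gtc , subst (λ z → toℚ (+ z) ℚ.< q) (trans (sym (ℕP.+-identityʳ k)) k+0≡a) k<q
  scan k       (suc r) k+r≡a  _    | tri> _ _ k<q = scan (suc k) r (trans (sym (ℕP.+-suc k r)) k+r≡a) k<q

compareℚ : ℚ → ℚ → Cmp
compareℚ p q with ℚP.<-cmp p q
... | tri< _ _ _ = lessF
... | tri≈ _ _ _ = equalF
... | tri> _ _ _ = greaterF

SatCmp-compareℚ : ∀ p q → SatCmp (compareℚ p q) p q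
SatCmp-compareℚ p q with ℚP.<-cmp p q
... | tri< p<q _ _ = p<q
... | tri≈ _ p≡q _ = p≡q
... | tri> _ _ q<p = q<p

regionOf : ∀ {n} (α : Fin n → ℕ) (v : Valuation n) → NonNeg v → Region α
regionOf α v 0≤v = record
  { con = λ x → proj₁ (clockConstraint (α x) (v x) (0≤v x))
  ; ord = λ x y → compareℚ (frac (v x)) (frac (v y))
  }

∈ᴿ-regionOf : ∀ {n} (α : Fin n → ℕ) (v : Valuation n) (0≤v : NonNeg v) → v ∈ᴿ regionOf α v 0≤v
∈ᴿ-regionOf α v 0≤v =
    0≤v
  , (λ x → proj₂ (clockConstraint (α x) (v x) (0≤v x)))
  , λ x y _ _ _ → SatCmp-compareℚ (frac (v x)) (frac (v y))

-- Infinitesimal weights and shortest paths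

-- K -ε· s stands for K - s·ε with ε > 0 infinitesimal, so that a strict bound (<, c) becomes the
-- non-strict c - ε and a sum of weights is strict exactly when its ε-count is positive.
infix 7 _-ε·_
data Weightε : Set where
  _-ε·_ : ℤ → ℕ → Weightε
  ∞ε    : Weightε

-- -∞ is sent to ∞ε only to make toε total; no edge of a satisfiable graph weighs -∞.
toε : Weight → Weightε
toε (fin le c) = c -ε· 0
toε (fin lt c) = c -ε· 1
toε ∞          = ∞ε
toε -∞         = ∞ε

fromε : Weightε → Weight
fromε (K -ε· zero)  = fin le K
fromε (K -ε· suc _) = fin lt K
fromε ∞ε            = ∞

εcount : Weightε → ℕ
εcount (_ -ε· s) = s
εcount ∞ε        = 0

0ε : Weightε
0ε = + 0 -ε· 0

infixl 6 _+ε_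
_+ε_ : Weightε → Weightε → Weightε
(K -ε· s) +ε (L -ε· t) = (K ℤ.+ L) -ε· (s ℕ.+ t)
(_ -ε· _) +ε ∞ε        = ∞ε
∞ε        +ε _         = ∞ε

infix 4 _≤ε_
data _≤ε_ : Weightε → Weightε → Set where
  ≤∞ε : ∀ {a} → a ≤ε ∞ε
  <ε  : ∀ {K L s t} → K ℤ.< L → K -ε· s ≤ε L -ε· t
  ≡ε  : ∀ {K s t} → t ℕ.≤ s → K -ε· s ≤ε K -ε· t

≤ε-refl : ∀ {a} → a ≤ε a
≤ε-refl {_ -ε· _} = ≡ε ℕP.≤-refl
≤ε-refl {∞ε}      = ≤∞ε

≤ε-trans : ∀ {a b c} → a ≤ε b → b ≤ε c → a ≤ε c
≤ε-trans _       ≤∞ε     = ≤∞ε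
≤ε-trans (<ε p) (<ε q) = <ε (ℤP.<-trans p q)
≤ε-trans (<ε p) (≡ε _) = <ε p
≤ε-trans (≡ε _) (<ε q) = <ε q
≤ε-trans (≡ε p) (≡ε q) = ≡ε (ℕP.≤-trans q p)

≤ε-total : ∀ a b → a ≤ε b ⊎ b ≤ε a
≤ε-total a         ∞ε        = inj₁ ≤∞ε
≤ε-total ∞ε        b         = inj₂ ≤∞ε
≤ε-total (K -ε· s) (L -ε· t) with ℤP.<-cmp K L
... | tri< K<L _ _  = inj₁ (<ε K<L)
... | tri> _ _ L<K  = inj₂ (<ε L<K)
... | tri≈ _ refl _ with ℕP.≤-total t s
...   | inj₁ t≤s = inj₁ (≡ε t≤s)
...   | inj₂ s≤t = inj₂ (≡ε s≤t)

+ε-monoˡ : ∀ {a a'} b → a ≤ε a' → a +ε b ≤ε a' +ε b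
+ε-monoˡ ∞ε        ≤∞ε       = ≤∞ε
+ε-monoˡ ∞ε        (<ε _)    = ≤∞ε
+ε-monoˡ ∞ε        (≡ε _)    = ≤∞ε
+ε-monoˡ (_ -ε· _) ≤∞ε       = ≤∞ε
+ε-monoˡ (L -ε· t) (<ε K<K') = <ε (ℤP.+-monoˡ-< L K<K')
+ε-monoˡ (L -ε· t) (≡ε s'≤s) = ≡ε (ℕP.+-monoˡ-≤ t s'≤s)

+ε-monoʳ : ∀ a {b b'} → b ≤ε b' → a +ε b ≤ε a +ε b'
+ε-monoʳ ∞ε        _         = ≤∞ε
+ε-monoʳ (_ -ε· _) ≤∞ε       = ≤∞ε
+ε-monoʳ (K -ε· s) (<ε L<L') = <ε (ℤP.+-monoʳ-< K L<L')
+ε-monoʳ (K -ε· s) (≡ε t'≤t) = ≡ε (ℕP.+-monoʳ-≤ s t'≤t)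

+ε-assoc : ∀ a b c → (a +ε b) +ε c ≡ a +ε (b +ε c)
+ε-assoc ∞ε        _         _         = refl
+ε-assoc (_ -ε· _) ∞ε        _         = refl
+ε-assoc (_ -ε· _) (_ -ε· _) ∞ε        = refl
+ε-assoc (K -ε· s) (L -ε· t) (M -ε· u) = cong₂ _-ε·_ (ℤP.+-assoc K L M) (ℕP.+-assoc s t u)

+ε-identityˡ : ∀ a → 0ε +ε a ≡ a
+ε-identityˡ ∞ε        = refl
+ε-identityˡ (K -ε· s) = cong (_-ε· s) (ℤP.+-identityˡ K)

fromε-mono : ∀ {a b} → a ≤ε b → fromε a ⊑ fromε b
fromε-mono ≤∞ε                            = ⊑∞
fromε-mono (<ε {s = zero}  {zero}  K<L)   = fin< K<L
fromε-mono (<ε {s = zero}  {suc _} K<L)   = fin< K<L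
fromε-mono (<ε {s = suc _} {zero}  K<L)   = fin< K<L
fromε-mono (<ε {s = suc _} {suc _} K<L)   = fin< K<L
fromε-mono (≡ε {s = zero}  {zero}  _)     = fin≡ le≤le
fromε-mono (≡ε {s = suc _} {zero}  _)     = fin≡ lt≤ˢ
fromε-mono (≡ε {s = suc _} {suc _} _)     = fin≡ lt≤ˢ

fromε-+ε : ∀ a b → fromε (a +ε b) ≡ fromε a +w fromε b
fromε-+ε ∞ε             (_ -ε· zero)  = refl
fromε-+ε ∞ε             (_ -ε· suc _) = refl
fromε-+ε ∞ε             ∞ε            = refl
fromε-+ε (_ -ε· zero)   ∞ε            = refl
fromε-+ε (_ -ε· suc _)  ∞ε            = refl
fromε-+ε (_ -ε· zero)   (_ -ε· zero)  = refl
fromε-+ε (_ -ε· zero)   (_ -ε· suc _) = refl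
fromε-+ε (_ -ε· suc _)  (_ -ε· zero)  = refl
fromε-+ε (_ -ε· suc _)  (_ -ε· suc _) = refl

fromε-toε : ∀ w → ¬ w ≡ -∞ → fromε (toε w) ≡ w
fromε-toε (fin lt _) _     = refl
fromε-toε (fin le _) _     = refl
fromε-toε ∞          _     = refl
fromε-toε -∞         w≢-∞ = ⊥-elim (w≢-∞ refl)

0ε≤ε : ∀ a → SatW ℚ.0ℚ (fromε a) → 0ε ≤ε a
0ε≤ε ∞ε            _   = ≤∞ε
0ε≤ε (K -ε· zero)  0≤K with ℤP.<-cmp (+ 0) K
... | tri< 0<K _ _  = <ε 0<K
... | tri≈ _ refl _ = ≡ε ℕ.z≤n
... | tri> _ _ K<0  = ⊥-elim (ℤP.<⇒≱ K<0 (toℚ-cancel-≤ (+ 0) K 0≤K))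
0ε≤ε (K -ε· suc s) 0<K = <ε (toℚ-cancel-< (+ 0) K 0<K)

split-at-lookup : ∀ {A : Set} (xs : List A) j → ∃₂ λ b c → xs ≡ b ++ lookup xs j ∷ c
split-at-lookup (x ∷ xs) fzero    = [] , xs , refl
split-at-lookup (x ∷ xs) (fsuc j) with split-at-lookup xs j
... | b , c , eq = x ∷ b , c , cong (x ∷_) eq

split-at-lookups : ∀ {A : Set} (xs : List A) i j → toℕ i ℕ.< toℕ j →
                   ∃ λ a → ∃₂ λ b c → xs ≡ a ++ lookup xs i ∷ b ++ lookup xs j ∷ c
split-at-lookups (x ∷ xs) fzero    (fsuc j) _ with split-at-lookup xs j
... | b , c , eq = [] , b , c , cong (x ∷_) eq
split-at-lookups (x ∷ xs) (fsuc i) (fsuc j) (ℕ.s≤s i<j) with split-at-lookups xs i j i<j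
... | a , b , c , eq = x ∷ a , b , c , cong (x ∷_) eq

split-at-repetition : ∀ {N} (xs : List (Fin N)) → N ℕ.< length xs →
                      ∃ λ a → ∃ λ u → ∃₂ λ b c → xs ≡ a ++ u ∷ b ++ u ∷ c
split-at-repetition xs N<len with FinP.pigeonhole N<len (lookup xs)
... | i , j , i<j , xsᵢ≡xsⱼ with split-at-lookups xs i j i<j
...   | a , b , c , eq =
  a , lookup xs i , b , c , trans eq (cong (λ z → a ++ lookup xs i ∷ b ++ z ∷ c) (sym xsᵢ≡xsⱼ))

infixl 7 _⊓ε_
_⊓ε_ : Weightε → Weightε → Weightε
a ⊓ε b with ≤ε-total a b
... | inj₁ _ = a
... | inj₂ _ = b

⊓ε-≤ˡ : ∀ a b → a ⊓ε b ≤ε a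
⊓ε-≤ˡ a b with ≤ε-total a b
... | inj₁ _   = ≤ε-refl
... | inj₂ b≤a = b≤a

⊓ε-≤ʳ : ∀ a b → a ⊓ε b ≤ε b
⊓ε-≤ʳ a b with ≤ε-total a b
... | inj₁ a≤b = a≤b
... | inj₂ _   = ≤ε-refl

⊓ε-sel : ∀ a b → a ⊓ε b ≡ a ⊎ a ⊓ε b ≡ b
⊓ε-sel a b with ≤ε-total a b
... | inj₁ _ = inj₁ refl
... | inj₂ _ = inj₂ refl

⨅ε : ∀ {m} → (Fin (suc m) → Weightε) → Weightε
⨅ε {zero}  f = f fzero
⨅ε {suc m} f = f fzero ⊓ε ⨅ε (f ∘ fsuc)

⨅ε-≤ : ∀ {m} (f : Fin (suc m) → Weightε) i → ⨅ε f ≤ε f i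
⨅ε-≤ {zero}  f fzero    = ≤ε-refl
⨅ε-≤ {suc m} f fzero    = ⊓ε-≤ˡ (f fzero) (⨅ε (f ∘ fsuc))
⨅ε-≤ {suc m} f (fsuc i) = ≤ε-trans (⊓ε-≤ʳ (f fzero) (⨅ε (f ∘ fsuc))) (⨅ε-≤ (f ∘ fsuc) i)

⨅ε-attained : ∀ {m} (f : Fin (suc m) → Weightε) → ∃ λ i → ⨅ε f ≡ f i
⨅ε-attained {zero}  f = fzero , refl
⨅ε-attained {suc m} f with ⊓ε-sel (f fzero) (⨅ε (f ∘ fsuc))
... | inj₁ eq = fzero , eq
... | inj₂ eq with ⨅ε-attained (f ∘ fsuc)
...   | i , eq' = fsuc i , trans eq eq'

∑ : ∀ {m} → (Fin m → ℕ) → ℕ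
∑ {zero}  f = 0
∑ {suc m} f = f fzero ℕ.+ ∑ (f ∘ fsuc)

≤-∑ : ∀ {m} (f : Fin m → ℕ) i → f i ℕ.≤ ∑ f
≤-∑ f fzero    = ℕP.m≤m+n (f fzero) _
≤-∑ f (fsuc i) = ℕP.≤-trans (≤-∑ (f ∘ fsuc) i) (ℕP.m≤n+m _ (f fzero))

module ShortestPaths {n : ℕ} (G : DistGraph n) {v₀ : Valuation n} (v₀∈G : v₀ ∈⟦ G ⟧) where

  edge≢-∞ : ∀ i j → ¬ G i j ≡ -∞
  edge≢-∞ i j eq = subst (SatW (val v₀ j ℚ.- val v₀ i)) eq (proj₂ v₀∈G i j)

  pathWeightε : Vertex n → List (Vertex n) → Vertex n → Weightε
  pathWeightε i []       j = toε (G i j)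
  pathWeightε i (k ∷ ks) j = toε (G i k) +ε pathWeightε k ks j

  fromε-pathWeightε : ∀ i ks j → fromε (pathWeightε i ks j) ≡ pathWeight G i ks j
  fromε-pathWeightε i []       j = fromε-toε (G i j) (edge≢-∞ i j)
  fromε-pathWeightε i (k ∷ ks) j = trans (fromε-+ε (toε (G i k)) (pathWeightε k ks j))
    (cong₂ _+w_ (fromε-toε (G i k) (edge≢-∞ i k)) (fromε-pathWeightε k ks j))

  pathWeightε-++ : ∀ i ks k ms j → pathWeightε i (ks ++ k ∷ ms) j ≡ pathWeightε i ks k +ε pathWeightε k ms j
  pathWeightε-++ i []        k ms j = refl
  pathWeightε-++ i (k' ∷ ks) k ms j = trans (cong (toε (G i k') +ε_) (pathWeightε-++ k' ks k ms j))
    (sym (+ε-assoc (toε (G i k')) (pathWeightε k' ks k) (pathWeightε k ms j)))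

  -- v₀ satisfies the cycle, and 0 ≼ w forces 0 ≤ w in the ε-order.
  cycle-nonneg : ∀ u ks → 0ε ≤ε pathWeightε u ks u
  cycle-nonneg u ks = 0ε≤ε (pathWeightε u ks u)
    (subst₂ SatW (ℚP.+-inverseʳ (val v₀ u)) (sym (fromε-pathWeightε u ks u)) (pathWeight-sound v₀∈G u ks u))

  remove-cycle : ∀ i a u b c j → pathWeightε i (a ++ u ∷ c) j ≤ε pathWeightε i (a ++ u ∷ b ++ u ∷ c) j
  remove-cycle i a u b c j
    rewrite pathWeightε-++ i a u c j | pathWeightε-++ i a u (b ++ u ∷ c) j | pathWeightε-++ u b u c j =
    +ε-monoʳ (pathWeightε i a u)
      (subst (_≤ε pathWeightε u b u +ε pathWeightε u c j) (+ε-identityˡ (pathWeightε u c j))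
        (+ε-monoˡ (pathWeightε u c j) (cycle-nonneg u b)))

  shorten : ∀ i ks j → ∃ λ ks' → length ks' ℕ.≤ suc n × pathWeightε i ks' j ≤ε pathWeightε i ks j
  shorten i ks j = go (length ks) ks ℕP.≤-refl
    where
    go : ∀ fuel ks → length ks ℕ.≤ fuel →
         ∃ λ ks' → length ks' ℕ.≤ suc n × pathWeightε i ks' j ≤ε pathWeightε i ks j
    go fuel ks len≤fuel with length ks ℕ.≤? suc n
    ... | yes short = ks , short , ≤ε-refl
    go zero ks len≤0 | no long = ⊥-elim (long (ℕP.≤-trans len≤0 ℕ.z≤n))
    go (suc fuel) ks len≤fuel | no long with split-at-repetition ks (ℕP.≰⇒> long)
    ... | a , u , b , c , refl with go fuel (a ++ u ∷ c) (ℕP.≤-pred (ℕP.≤-trans shorter len≤fuel))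
      where
      shorter : length (a ++ u ∷ c) ℕ.< length (a ++ u ∷ b ++ u ∷ c)
      shorter rewrite ListP.length-++ a {u ∷ c} | ListP.length-++ a {u ∷ b ++ u ∷ c} | ListP.length-++ b {u ∷ c} =
        ℕP.+-monoʳ-< (length a) (ℕ.s≤s (ℕP.m≤n+m (suc (length c)) (length b)))
    ... | ks' , len' , ks'≤ = ks' , len' , ≤ε-trans ks'≤ (remove-cycle i a u b c j)

  bestWithin : Vertex n → ℕ → Vertex n → Weightε
  bestWithin i zero    j = toε (G i j)
  bestWithin i (suc k) j = toε (G i j) ⊓ε ⨅ε (λ u → toε (G i u) +ε bestWithin u k j)

  bestWithin-attained : ∀ i k j → ∃ λ ks → bestWithin i k j ≡ pathWeightε i ks j
  bestWithin-attained i zero    j = [] , refl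
  bestWithin-attained i (suc k) j with ⊓ε-sel (toε (G i j)) (⨅ε (λ u → toε (G i u) +ε bestWithin u k j))
  ... | inj₁ eq = [] , eq
  ... | inj₂ eq with ⨅ε-attained (λ u → toε (G i u) +ε bestWithin u k j)
  ...   | u , eq' with bestWithin-attained u k j
  ...     | ks , eq'' = u ∷ ks , trans eq (trans eq' (cong (toε (G i u) +ε_) eq''))

  bestWithin-least : ∀ i k j ks → length ks ℕ.≤ k → bestWithin i k j ≤ε pathWeightε i ks j
  bestWithin-least i zero    j []       _ = ≤ε-refl
  bestWithin-least i (suc k) j []       _ = ⊓ε-≤ˡ (toε (G i j)) (⨅ε (λ u → toε (G i u) +ε bestWithin u k j))
  bestWithin-least i (suc k) j (u ∷ ks) (ℕ.s≤s len≤k) =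
    ≤ε-trans (⊓ε-≤ʳ (toε (G i j)) (⨅ε (λ u → toε (G i u) +ε bestWithin u k j)))
      (≤ε-trans (⨅ε-≤ (λ u → toε (G i u) +ε bestWithin u k j) u)
        (+ε-monoʳ (toε (G i u)) (bestWithin-least u k j ks len≤k)))

  distε : Vertex n → Vertex n → Weightε
  distε i j = bestWithin i (suc n) j

  distε-least : ∀ i ks j → distε i j ≤ε pathWeightε i ks j
  distε-least i ks j with shorten i ks j
  ... | ks' , len' , ks'≤ = ≤ε-trans (bestWithin-least i (suc n) j ks' len') ks'≤

  potential : Vertex n → Vertex n → Weightε
  potential s y with y Fin.≟ s
  ... | yes _ = 0ε
  ... | no _  = distε s y

  potential-source : ∀ s → potential s s ≡ 0ε
  potential-source s with s Fin.≟ s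
  ... | yes _  = refl
  ... | no s≢s = ⊥-elim (s≢s refl)

  potential-least : ∀ s ks y → potential s y ≤ε pathWeightε s ks y
  potential-least s ks y with y Fin.≟ s
  ... | yes refl = cycle-nonneg s ks
  ... | no _     = distε-least s ks y

  potential-triangle : ∀ s z y → potential s y ≤ε potential s z +ε toε (G z y)
  potential-triangle s z y with z Fin.≟ s
  ... | yes refl = subst (potential s y ≤ε_) (sym (+ε-identityˡ (toε (G s y)))) (potential-least s [] y)
  ... | no _ with bestWithin-attained s (suc n) z
  ...   | ks , eq = subst (potential s y ≤ε_) (trans (pathWeightε-++ s ks z [] y) (cong (_+ε toε (G z y)) (sym eq)))
                      (potential-least s (ks ++ z ∷ []) y)

  potential-leastPath : ∀ s t {Z} → t ≢ s → LeastPath G s t Z → fromε (potential s t) ≡ Z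
  potential-leastPath s t t≢s ((ks₀ , refl) , least) with t Fin.≟ s
  ... | yes t≡s = ⊥-elim (t≢s t≡s)
  ... | no _ with bestWithin-attained s (suc n) t
  ...   | ks , eq = ⊑-antisym
    (subst (fromε (distε s t) ⊑_) (fromε-pathWeightε s ks₀ t) (fromε-mono (distε-least s ks₀ t)))
    (subst (pathWeight G s ks₀ t ⊑_) (sym (trans (cong fromε eq) (fromε-pathWeightε s ks t))) (≤w⇒⊑ (least ks)))

-- Valuations at the ends of the range of a clock

-- Instantiating ε := 1/(M+1) and multiplying by M+1 keeps everything integral.
scale : ℕ → Weightε → ℤ
scale M (K -ε· s) = + suc M ℤ.* K ℤ.- + s
scale M ∞ε        = + 0

scale-+ε : ∀ M K s L t → scale M ((K -ε· s) +ε (L -ε· t)) ≡ scale M (K -ε· s) ℤ.+ scale M (L -ε· t)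
scale-+ε M K s L t =
  trans (cong (λ z → + suc M ℤ.* (K ℤ.+ L) ℤ.- z) (ℤP.pos-+ s t)) (ring (+ suc M) K (+ s) L (+ t))
  where
  ring : ∀ D K s L t → D ℤ.* (K ℤ.+ L) ℤ.- (s ℤ.+ t) ≡ (D ℤ.* K ℤ.- s) ℤ.+ (D ℤ.* L ℤ.- t)
  ring = solve-∀

-- ε := 1/(M+1) is small enough for the ε-order as long as ε-counts stay ≤ M+1.
scale-mono : ∀ M {K s L t} → t ℕ.≤ suc M → K -ε· s ≤ε L -ε· t →
             scale M (K -ε· s) ℤ.≤ scale M (L -ε· t)
scale-mono M {K} {s} {L} {t} t≤1+M (<ε K<L) =
  ℤP.0≤i-j⇒j≤i (subst (+ 0 ℤ.≤_) (sym (ring (+ suc M) K (+ s) L (+ t)))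
                      (ℤP.+-mono-≤ 0≤D*[L-K-1] 0≤D-t+s))
  where
  ring : ∀ D K s L t →
         (D ℤ.* L ℤ.- t) ℤ.- (D ℤ.* K ℤ.- s) ≡ D ℤ.* (L ℤ.- (K ℤ.+ ℤ.1ℤ)) ℤ.+ ((D ℤ.- t) ℤ.+ s)
  ring = solve-∀
  0≤D*[L-K-1] : + 0 ℤ.≤ + suc M ℤ.* (L ℤ.- (K ℤ.+ ℤ.1ℤ))
  0≤D*[L-K-1] = subst (ℤ._≤ + suc M ℤ.* (L ℤ.- (K ℤ.+ ℤ.1ℤ))) (ℤP.*-zeroʳ (+ suc M))
    (ℤP.*-monoˡ-≤-nonNeg (+ suc M) (ℤP.i≤j⇒0≤j-i (i<j⇒i+1≤j K<L)))
  0≤D-t+s : + 0 ℤ.≤ (+ suc M ℤ.- + t) ℤ.+ + s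
  0≤D-t+s = ℤP.+-mono-≤ (ℤP.i≤j⇒0≤j-i (ℤ.+≤+ t≤1+M)) (ℤ.+≤+ ℕ.z≤n)
scale-mono M {K} _ (≡ε t≤s) = ℤP.+-monoʳ-≤ (+ suc M ℤ.* K) (ℤP.neg-mono-≤ (ℤ.+≤+ t≤s))

scale-SatW : ∀ M i t k → i ℤ.≤ scale M (toε (fin t k)) → SatW (i /1+ M) (fin t k)
scale-SatW M i le k i≤ = subst (i /1+ M ℚ.≤_) (sym (toℚ≡*/1+ M k))
  (/1+-mono-≤ M (subst (i ℤ.≤_) (ℤP.+-identityʳ (+ suc M ℤ.* k)) i≤))
scale-SatW M i lt k i≤ = subst (i /1+ M ℚ.<_) (sym (toℚ≡*/1+ M k))
  (/1+-mono-< M (ℤP.≤-<-trans i≤ (i-1<i (+ suc M ℤ.* k))))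

scale-difference-≤ : ∀ M Ka sa Kb sb L u → sb ℕ.+ u ℕ.≤ suc M →
                     Ka -ε· sa ≤ε (Kb -ε· sb) +ε (L -ε· u) →
            scale M (Ka -ε· sa) ℤ.- scale M (Kb -ε· sb) ℤ.≤ scale M (L -ε· u)
scale-difference-≤ M Ka sa Kb sb L u count≤ a≤b+w =
  subst (_ ℤ.≤_) (ring (scale M (Kb -ε· sb)) (scale M (L -ε· u)))
    (ℤP.+-monoˡ-≤ (- scale M (Kb -ε· sb))
      (subst (scale M (Ka -ε· sa) ℤ.≤_) (scale-+ε M Kb sb L u) (scale-mono M count≤ a≤b+w)))
  where
  ring : ∀ i j → (i ℤ.+ j) ℤ.- i ≡ j
  ring = solve-∀

scale-edge : ∀ M Ka sa Kb sb t k → sb ℕ.≤ M → Ka -ε· sa ≤ε (Kb -ε· sb) +ε toε (fin t k) →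
             SatW ((scale M (Ka -ε· sa) ℤ.- scale M (Kb -ε· sb)) /1+ M) (fin t k)
scale-edge M Ka sa Kb sb le k sb≤M a≤b+w =
  scale-SatW M _ le k (scale-difference-≤ M Ka sa Kb sb k 0 count≤ a≤b+w)
  where
  count≤ : sb ℕ.+ 0 ℕ.≤ suc M
  count≤ = ℕP.≤-trans (ℕP.≤-reflexive (ℕP.+-identityʳ sb)) (ℕP.m≤n⇒m≤1+n sb≤M)
scale-edge M Ka sa Kb sb lt k sb≤M a≤b+w =
  scale-SatW M _ lt k (scale-difference-≤ M Ka sa Kb sb k 1 count≤ a≤b+w)
  where
  count≤ : sb ℕ.+ 1 ℕ.≤ suc M
  count≤ = subst (ℕ._≤ suc M) (ℕP.+-comm 1 sb) (ℕ.s≤s sb≤M)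

scale-0ε : ∀ M → scale M 0ε ≡ + 0
scale-0ε M = trans (ℤP.+-identityʳ (+ suc M ℤ.* + 0)) (ℤP.*-zeroʳ (+ suc M))

scale-exact : ∀ M K → scale M (K -ε· 0) /1+ M ≡ toℚ K
scale-exact M K = trans (cong (_/1+ M) (ℤP.+-identityʳ (+ suc M ℤ.* K))) (sym (toℚ≡*/1+ M K))

scale-between : ∀ M K t → 1 ℕ.≤ t → t ℕ.≤ M →
                toℚ (K ℤ.- ℤ.1ℤ) ℚ.< scale M (K -ε· t) /1+ M × scale M (K -ε· t) /1+ M ℚ.< toℚ K
scale-between M K t 1≤t t≤M =
  subst (ℚ._< scale M (K -ε· t) /1+ M) (sym (toℚ≡*/1+ M (K ℤ.- ℤ.1ℤ))) (/1+-mono-< M below) ,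
  subst (scale M (K -ε· t) /1+ M ℚ.<_) (sym (toℚ≡*/1+ M K)) (/1+-mono-< M above)
  where
  D : ℤ
  D = + suc M
  ring : ∀ D K t → D ℤ.* (K ℤ.- ℤ.1ℤ) ℤ.+ (D ℤ.- t) ≡ D ℤ.* K ℤ.- t
  ring = solve-∀
  below : D ℤ.* (K ℤ.- ℤ.1ℤ) ℤ.< D ℤ.* K ℤ.- + t
  below = subst₂ ℤ._<_ (ℤP.+-identityʳ _) (ring D K (+ t))
    (ℤP.+-monoʳ-< (D ℤ.* (K ℤ.- ℤ.1ℤ)) (subst (ℤ._< D ℤ.- + t) (ℤP.+-inverseʳ (+ t))
      (ℤP.+-monoˡ-< (- + t) (ℤ.+<+ (ℕ.s≤s t≤M)))))
  above : D ℤ.* K ℤ.- + t ℤ.< D ℤ.* K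
  above = subst (D ℤ.* K ℤ.- + t ℤ.<_) (ℤP.+-identityʳ (D ℤ.* K))
    (ℤP.+-monoʳ-< (D ℤ.* K) (ℤP.neg-mono-< (ℤ.+<+ 1≤t)))

infixl 7 _⊓ᵐ_
_⊓ᵐ_ : ℚ → Maybe ℚ → ℚ
q ⊓ᵐ nothing = q
q ⊓ᵐ just p  = q ℚ.⊓ p

⊓ᵐ-≤ : ∀ q m → q ⊓ᵐ m ℚ.≤ q
⊓ᵐ-≤ q nothing  = ℚP.≤-refl
⊓ᵐ-≤ q (just p) = ℚP.p⊓q≤p q p

PartialSolution : ∀ {n} → DistGraph n → (Vertex n → Maybe ℚ) → Set
PartialSolution G p = ∀ i j {pᵢ} → p i ≡ just pᵢ → ∀ {t k} → G i j ≡ fin t k →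
                      ∃ λ pⱼ → p j ≡ just pⱼ × SatW (pⱼ ℚ.- pᵢ) (fin t k)

⊓ᵐ-SatW : ∀ w a b ma mb → SatW (b ℚ.- a) w →
          (∀ {pa} → ma ≡ just pa → ∀ {t k} → w ≡ fin t k →
             ∃ λ pb → mb ≡ just pb × SatW (pb ℚ.- pa) (fin t k)) →
          SatW (b ⊓ᵐ mb ℚ.- a ⊓ᵐ ma) w
⊓ᵐ-SatW w a b nothing   mb b-a≼w _ = SatW-antitone w (ℚP.+-monoˡ-≤ (ℚ.- a) (⊓ᵐ-≤ b mb)) b-a≼w
⊓ᵐ-SatW w a b (just pa) mb b-a≼w extend with ℚP.⊓-sel a pa
... | inj₁ a⊓pa≡a  rewrite a⊓pa≡a  = SatW-antitone w (ℚP.+-monoˡ-≤ (ℚ.- a) (⊓ᵐ-≤ b mb)) b-a≼w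
... | inj₂ a⊓pa≡pa rewrite a⊓pa≡pa with w | extend {pa} refl
...   | ∞       | _     = tt
...   | -∞      | _     = ⊥-elim b-a≼w
...   | fin t k | ext with ext refl
...     | pb , refl , pb-pa≼w = SatW-antitone (fin t k) (ℚP.+-monoˡ-≤ (ℚ.- pa) (ℚP.p⊓q≤q b pb)) pb-pa≼w

module _ {n : ℕ} {G : DistGraph n} {v : Valuation n} (v∈G : v ∈⟦ G ⟧)
         (clocks-nonneg : ∀ y → G (fsuc y) fzero ≤w fin le (+ 0))
         {p : Vertex n → Maybe ℚ} (p-solution : PartialSolution G p) (p₀ : p fzero ≡ just ℚ.0ℚ)
         {T : ℚ} (0≤T : ℚ.0ℚ ℚ.≤ T) where

  envelope : Valuation n
  envelope x = (v x ℚ.+ T) ⊓ᵐ p (fsuc x)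

  private
    val-envelope : ∀ y → val envelope y ≡ (val v y ℚ.+ T) ⊓ᵐ p y
    val-envelope fzero    rewrite p₀ =
      sym (ℚP.p≥q⇒p⊓q≡q (subst (ℚ.0ℚ ℚ.≤_) (sym (ℚP.+-identityˡ T)) 0≤T))
    val-envelope (fsuc x) = refl

    envelope-edges : ∀ i j → SatW (val envelope j ℚ.- val envelope i) (G i j)
    envelope-edges i j rewrite val-envelope i | val-envelope j =
      ⊓ᵐ-SatW (G i j) (val v i ℚ.+ T) (val v j ℚ.+ T) (p i) (p j)
        (subst (λ q → SatW q (G i j)) (sym (shift (val v i) (val v j) T)) (proj₂ v∈G i j))
        (p-solution i j)
      where
      open +-*-Solver
      shift : ∀ a b T → (b ℚ.+ T) ℚ.- (a ℚ.+ T) ≡ b ℚ.- a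
      shift = solve 3 (λ a b T → (b :+ T) :- (a :+ T) := b :- a) refl

  envelope-∈ : envelope ∈⟦ G ⟧
  envelope-∈ = (λ x → 0-q≤d⇒-d≤q (+ 0) (SatW-⊑ (envelope-edges (fsuc x) fzero) (≤w⇒⊑ (clocks-nonneg x))))
             , envelope-edges

module TightValuations {n : ℕ} {G : DistGraph n} {v₀ : Valuation n} (v₀∈G : v₀ ∈⟦ G ⟧)
                       (clocks-nonneg : ∀ y → G (fsuc y) fzero ≤w fin le (+ 0)) (s : Vertex n) where

  open ShortestPaths G v₀∈G public

  M : ℕ
  M = ∑ (εcount ∘ potential s)

  εcount≤M : ∀ y → εcount (potential s y) ℕ.≤ M
  εcount≤M = ≤-∑ (εcount ∘ potential s)

  valueAt : Weightε → Maybe ℚ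
  valueAt (K -ε· t) = just ((scale M (K -ε· t) ℤ.- scale M (potential s fzero)) /1+ M)
  valueAt ∞ε        = nothing

  potentialValue : Vertex n → Maybe ℚ
  potentialValue y = valueAt (potential s y)

  potentialValue-solution : PartialSolution G potentialValue
  potentialValue-solution i j {pᵢ} pᵢ≡ {t} {k} Gij≡
    with potential s i | potential s j | potential-triangle s i j | εcount≤M i
  ... | ∞ε       | _        | _   | _ = case pᵢ≡ of λ ()
  ... | Ki -ε· si | ∞ε       | tri | _ rewrite Gij≡ with t | tri
  ...   | lt | ()
  ...   | le | ()
  potentialValue-solution i j refl {t} {k} Gij≡
      | Ki -ε· si | Kj -ε· sj | tri | si≤M rewrite Gij≡ =
    _ , refl , subst (λ q → SatW q (fin t k)) (relative (scale M (Kj -ε· sj)) (scale M (Ki -ε· si)))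
                 (scale-edge M Kj sj Ki si t k si≤M tri)
    where
    c : ℤ
    c = scale M (potential s fzero)
    relative : ∀ a b → (a ℤ.- b) /1+ M ≡ (a ℤ.- c) /1+ M ℚ.- (b ℤ.- c) /1+ M
    relative a b = trans (cong (_/1+ M) (ring a b c)) (/1+-- M (a ℤ.- c) (b ℤ.- c))
      where
      ring : ∀ a b c → a ℤ.- b ≡ (a ℤ.- c) ℤ.- (b ℤ.- c)
      ring = solve-∀

  module _ {K₀ t₀} (potential₀ : potential s fzero ≡ K₀ -ε· t₀) where

    private
      potentialValue₀ : potentialValue fzero ≡ just ℚ.0ℚ
      potentialValue₀ = begin
        valueAt (potential s fzero)                        ≡⟨ cong valueAt potential₀ ⟩
        just ((c₀ ℤ.- scale M (potential s fzero)) /1+ M)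
          ≡⟨ cong (λ w → just ((c₀ ℤ.- scale M w) /1+ M)) potential₀ ⟩
        just ((c₀ ℤ.- c₀) /1+ M)
          ≡⟨ cong (λ i → just (i /1+ M)) (ℤP.+-inverseʳ c₀) ⟩
        just ((+ 0) /1+ M)                                 ≡⟨ cong just (ℚP.0/n≡0 (suc M)) ⟩
        just ℚ.0ℚ                                          ∎
        where
        open ≡-Reasoning
        c₀ : ℤ
        c₀ = scale M (K₀ -ε· t₀)

      envelopeAt : ∀ {T} → ℚ.0ℚ ℚ.≤ T → Valuation n
      envelopeAt 0≤T = envelope v₀∈G clocks-nonneg potentialValue-solution potentialValue₀ 0≤T

      envelopeAt-∈ : ∀ {T} (0≤T : ℚ.0ℚ ℚ.≤ T) → envelopeAt 0≤T ∈⟦ G ⟧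
      envelopeAt-∈ = envelope-∈ v₀∈G clocks-nonneg potentialValue-solution potentialValue₀

    tight : ∀ x {K t} → potential s (fsuc x) ≡ K -ε· t →
            ∃ λ u → u ∈⟦ G ⟧ × u x ≡ (scale M (K -ε· t) ℤ.- scale M (K₀ -ε· t₀)) /1+ M
    tight x {K} {t} potentialₓ = envelopeAt 0≤T , envelopeAt-∈ 0≤T , at-x
      where
      P : ℚ
      P = (scale M (K -ε· t) ℤ.- scale M (K₀ -ε· t₀)) /1+ M
      0≤T : ℚ.0ℚ ℚ.≤ P ℚ.⊔ ℚ.0ℚ
      0≤T = ℚP.p≤q⊔p P ℚ.0ℚ
      P≤v₀+T : P ℚ.≤ v₀ x ℚ.+ (P ℚ.⊔ ℚ.0ℚ)
      P≤v₀+T = ℚP.≤-trans (ℚP.p≤p⊔q P ℚ.0ℚ) (q≤p+q (proj₁ v₀∈G x))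
      at-x : envelopeAt 0≤T x ≡ P
      at-x rewrite potentialₓ =
        subst (λ w → (v₀ x ℚ.+ (P ℚ.⊔ ℚ.0ℚ)) ℚ.⊓ ((scale M (K -ε· t) ℤ.- scale M w) /1+ M) ≡ P)
              (sym potential₀) (ℚP.p≥q⇒p⊓q≡q P≤v₀+T)

    unbounded : ∀ x → potential s (fsuc x) ≡ ∞ε → ∀ c → ∃ λ u → u ∈⟦ G ⟧ × toℚ (+ c) ℚ.< u x
    unbounded x potentialₓ c = envelopeAt 0≤T , envelopeAt-∈ 0≤T , c<u
      where
      0≤T : ℚ.0ℚ ℚ.≤ toℚ (+ suc c)
      0≤T = toℚ-mono-≤ (ℤ.+≤+ (ℕ.z≤n {suc c}))
      c<u : toℚ (+ c) ℚ.< envelopeAt 0≤T x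
      c<u rewrite potentialₓ = ℚP.<-≤-trans (toℚ-mono-< (ℤ.+<+ (ℕP.n<1+n c))) (q≤p+q (proj₁ v₀∈G x))

module _ {n : ℕ} {G : DistGraph n} {v₀ : Valuation n} (v₀∈G : v₀ ∈⟦ G ⟧)
         (clocks-nonneg : ∀ y → G (fsuc y) fzero ≤w fin le (+ 0)) (x : Fin n) where

  private
    module Fromₓ = TightValuations v₀∈G clocks-nonneg (fsuc x)
    module From₀ = TightValuations v₀∈G clocks-nonneg fzero

    negated : ∀ M i → (scale M 0ε ℤ.- i) /1+ M ≡ ℚ.- (i /1+ M)
    negated M i = trans (cong (λ z → (z ℤ.- i) /1+ M) (scale-0ε M))
                        (trans (cong (_/1+ M) (ℤP.+-identityˡ (- i))) (/1+-neg M i))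

    unshifted : ∀ M i → (i ℤ.- scale M 0ε) /1+ M ≡ i /1+ M
    unshifted M i = trans (cong (λ z → (i ℤ.- z) /1+ M) (scale-0ε M)) (cong (_/1+ M) (ℤP.+-identityʳ i))

  attains-lower-le : ∀ {d} → LeastPath G (fsuc x) fzero (fin le d) → ∃ λ u → u ∈⟦ G ⟧ × u x ≡ toℚ (- d)
  attains-lower-le {d} least
    with Fromₓ.potential (fsuc x) fzero in eq | Fromₓ.potential-leastPath (fsuc x) fzero (λ ()) least
  ... | .d -ε· zero | refl with Fromₓ.tight eq x (Fromₓ.potential-source (fsuc x))
  ...   | u , u∈G , uₓ≡ = u , u∈G , (begin
    u x                                                       ≡⟨ uₓ≡ ⟩
    (scale M 0ε ℤ.- scale M (d -ε· 0)) /1+ M                  ≡⟨ negated M (scale M (d -ε· 0)) ⟩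
    ℚ.- (scale M (d -ε· 0) /1+ M)                              ≡⟨ cong ℚ.-_ (scale-exact M d) ⟩
    ℚ.- toℚ d                                                  ≡⟨ sym (/1+-neg 0 d) ⟩
    toℚ (- d)                                                  ∎)
    where
    open ≡-Reasoning
    M : ℕ
    M = Fromₓ.M

  attains-lower-lt : ∀ {d} → LeastPath G (fsuc x) fzero (fin lt d) →
                     ∃ λ u → u ∈⟦ G ⟧ × toℚ (- d) ℚ.< u x × u x ℚ.< toℚ (- d ℤ.+ ℤ.1ℤ)
  attains-lower-lt {d} least
    with Fromₓ.potential (fsuc x) fzero in eq | Fromₓ.potential-leastPath (fsuc x) fzero (λ ()) least
  ... | .d -ε· suc t | refl with Fromₓ.tight eq x (Fromₓ.potential-source (fsuc x))
  ...   | u , u∈G , uₓ≡ = u , u∈G ,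
    subst₂ ℚ._<_ (sym (/1+-neg 0 d)) (sym uₓ≡-S) (ℚP.neg-antimono-< (proj₂ bounds)) ,
    subst₂ ℚ._<_ (sym uₓ≡-S) (trans (sym (/1+-neg 0 (d ℤ.- ℤ.1ℤ))) (cong toℚ (ring d)))
                 (ℚP.neg-antimono-< (proj₁ bounds))
    where
    M : ℕ
    M = Fromₓ.M
    uₓ≡-S : u x ≡ ℚ.- (scale M (d -ε· suc t) /1+ M)
    uₓ≡-S = trans uₓ≡ (negated M (scale M (d -ε· suc t)))
    bounds : toℚ (d ℤ.- ℤ.1ℤ) ℚ.< scale M (d -ε· suc t) /1+ M × scale M (d -ε· suc t) /1+ M ℚ.< toℚ d
    bounds = scale-between M d (suc t) (ℕ.s≤s ℕ.z≤n)
                           (subst (λ a → εcount a ℕ.≤ M) eq (Fromₓ.εcount≤M fzero))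
    ring : ∀ d → - (d ℤ.- ℤ.1ℤ) ≡ - d ℤ.+ ℤ.1ℤ
    ring = solve-∀

  attains-upper-le : ∀ {d} → LeastPath G fzero (fsuc x) (fin le d) → ∃ λ u → u ∈⟦ G ⟧ × u x ≡ toℚ d
  attains-upper-le {d} least
    with From₀.potential fzero (fsuc x) in eq | From₀.potential-leastPath fzero (fsuc x) (λ ()) least
  ... | .d -ε· zero | refl with From₀.tight (From₀.potential-source fzero) x eq
  ...   | u , u∈G , uₓ≡ = u , u∈G ,
    trans uₓ≡ (trans (unshifted From₀.M (scale From₀.M (d -ε· 0))) (scale-exact From₀.M d))

  attains-upper-lt : ∀ {d} → LeastPath G fzero (fsuc x) (fin lt d) →
                     ∃ λ u → u ∈⟦ G ⟧ × toℚ (d ℤ.- ℤ.1ℤ) ℚ.< u x × u x ℚ.< toℚ d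
  attains-upper-lt {d} least
    with From₀.potential fzero (fsuc x) in eq | From₀.potential-leastPath fzero (fsuc x) (λ ()) least
  ... | .d -ε· suc t | refl with From₀.tight (From₀.potential-source fzero) x eq
  ...   | u , u∈G , uₓ≡ = u , u∈G ,
    subst (toℚ (d ℤ.- ℤ.1ℤ) ℚ.<_) (sym uₓ≡-S) (proj₁ bounds) ,
    subst (ℚ._< toℚ d) (sym uₓ≡-S) (proj₂ bounds)
    where
    M : ℕ
    M = From₀.M
    uₓ≡-S : u x ≡ scale M (d -ε· suc t) /1+ M
    uₓ≡-S = trans uₓ≡ (unshifted M (scale M (d -ε· suc t)))
    bounds : toℚ (d ℤ.- ℤ.1ℤ) ℚ.< scale M (d -ε· suc t) /1+ M × scale M (d -ε· suc t) /1+ M ℚ.< toℚ d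
    bounds = scale-between M d (suc t) (ℕ.s≤s ℕ.z≤n)
                           (subst (λ a → εcount a ℕ.≤ M) eq (From₀.εcount≤M (fsuc x)))

  unbounded-above : LeastPath G fzero (fsuc x) ∞ → ∀ c → ∃ λ u → u ∈⟦ G ⟧ × toℚ (+ c) ℚ.< u x
  unbounded-above least
    with From₀.potential fzero (fsuc x) in eq | From₀.potential-leastPath fzero (fsuc x) (λ ()) least
  ... | ∞ε          | refl = From₀.unbounded (From₀.potential-source fzero) x eq
  ... | _ -ε· zero  | ()
  ... | _ -ε· suc _ | ()

-- Least edges of the regions meeting a zone

module RegionEdges {n : ℕ} (α : Fin n → ℕ) {G : DistGraph n} {v₀ : Valuation n} (v₀∈G : v₀ ∈⟦ G ⟧)
                   (clocks-nonneg : ∀ y → G (fsuc y) fzero ≤w fin le (+ 0)) (x : Fin n) where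

  RegionEdge : Vertex n → Vertex n → Weight → Set
  RegionEdge i j w = ∃ λ (R : Region α) → (∃ λ v → v ∈⟦ G ⟧ × v ∈ᴿ R) × LeastPath (regionGraph α R) i j w

  private
    regionAt : ∀ {u} → u ∈⟦ G ⟧ → Region α
    regionAt u∈G = regionOf α _ (proj₁ u∈G)

    satAt : ∀ {u} (u∈G : u ∈⟦ G ⟧) → SatClock (con (regionAt u∈G) x) (u x)
    satAt u∈G = proj₁ (proj₂ (∈ᴿ-regionOf α _ (proj₁ u∈G))) x

    edge₀ₓ : ∀ {u} (u∈G : u ∈⟦ G ⟧) {w} → regionGraph α (regionAt u∈G) fzero (fsuc x) ≡ w →
             RegionEdge fzero (fsuc x) w
    edge₀ₓ u∈G refl =
      regionAt u∈G , (_ , u∈G , ∈ᴿ-regionOf α _ (proj₁ u∈G)) , regionGraph-least-from0 (regionAt u∈G) (fsuc x)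

    edgeₓ₀ : ∀ {u} (u∈G : u ∈⟦ G ⟧) {w} → regionGraph α (regionAt u∈G) (fsuc x) fzero ≡ w →
             RegionEdge (fsuc x) fzero w
    edgeₓ₀ u∈G refl =
      regionAt u∈G , (_ , u∈G , ∈ᴿ-regionOf α _ (proj₁ u∈G)) , regionGraph-least-to0 (regionAt u∈G) (fsuc x)

    below₀ₓ : ∀ {t} → (∀ R {v} → v ∈⟦ G ⟧ → v ∈ᴿ R → t ⊑ regionGraph α R fzero (fsuc x)) →
              ∀ w → RegionEdge fzero (fsuc x) w → t ≤w w
    below₀ₓ {t} bound w (R , (v , v∈G , v∈R) , least) =
      ⊑⇒≤w (subst (t ⊑_) (leastPath-unique (regionGraph-least-from0 R (fsuc x)) least) (bound R v∈G v∈R))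

    belowₓ₀ : ∀ {t} → (∀ R {v} → v ∈⟦ G ⟧ → v ∈ᴿ R → t ⊑ regionGraph α R (fsuc x) fzero) →
              ∀ w → RegionEdge (fsuc x) fzero w → t ≤w w
    belowₓ₀ {t} bound w (R , (v , v∈G , v∈R) , least) =
      ⊑⇒≤w (subst (t ⊑_) (leastPath-unique (regionGraph-least-to0 R (fsuc x)) least) (bound R v∈G v∈R))

    α⁻ : Weight
    α⁻ = fin lt (- (+ α x))

  least-0x-beyond : ∀ {Z} → LeastPath G (fsuc x) fzero Z → Z <w fin le (- (+ α x)) →
                    IsLeast (RegionEdge fzero (fsuc x)) ∞
  least-0x-beyond least Z<-α =
      edge₀ₓ v₀∈G (proj₁ (regionGraph-above (regionAt v₀∈G) x (satAt v₀∈G) (beyond v₀∈G)))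
    , below₀ₓ λ R v∈G v∈R →
        ⊑-reflexive (sym (proj₁ (regionGraph-above R x (proj₁ (proj₂ v∈R) x) (beyond v∈G))))
    where
    beyond : ∀ {v} → v ∈⟦ G ⟧ → toℚ (+ α x) ℚ.< v x
    beyond v∈G = subst (ℚ._< _) (cong toℚ (ℤP.neg-involutive (+ α x)))
      (0-q<d⇒-d<q (- (+ α x)) (SatW-⊑ (leastPath-sound v∈G least) (<w-le⇒⊑-lt Z<-α)))

  least-0x : ∀ {Z} → LeastPath G (fsuc x) fzero Z → ¬ Z <w fin le (- (+ α x)) →
             IsLeast (RegionEdge fzero (fsuc x)) (ceilw (negw Z))
  least-0x {Z} least Z≮-α =
      attained Z least (≮w⇒⊑ Z≮-α)
    , below₀ₓ λ R v∈G v∈R → regionGraph-0x-lower R x (proj₁ (proj₂ v∈R) x) Z (leastPath-sound v∈G least)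
    where
    attained : ∀ Z → LeastPath G (fsuc x) fzero Z → fin le (- (+ α x)) ⊑ Z →
               RegionEdge fzero (fsuc x) (ceilw (negw Z))
    attained -∞ least _ = ⊥-elim (leastPath-sound v₀∈G least)
    attained ∞ least _ =
      case ⊑-trans (≤w⇒⊑ {∞} {G (fsuc x) fzero} (proj₂ least []))
                   (≤w⇒⊑ {b = fin le (+ 0)} (clocks-nonneg x)) of λ ()
    attained (fin le d) least -α≤d with attains-lower-le v₀∈G clocks-nonneg x least
    ... | u , u∈G , uₓ≡ = edge₀ₓ u∈G
      (proj₁ (regionGraph-at-integer (regionAt u∈G) x (satAt u∈G) (- d) uₓ≡
      (subst (- d ℤ.≤_) (ℤP.neg-involutive (+ α x)) (ℤP.neg-mono-≤ (fin⊑fin⇒≤ -α≤d)))))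
    attained (fin lt d) least -α<d with attains-lower-lt v₀∈G clocks-nonneg x least
    ... | u , u∈G , lo , hi = edge₀ₓ u∈G
      (proj₁ (regionGraph-between (regionAt u∈G) x (satAt u∈G) (- d ℤ.+ ℤ.1ℤ)
      (subst (λ c → toℚ c ℚ.< u x) (sym (ring d)) lo) hi
      (i<j⇒i+1≤j (subst (- d ℤ.<_) (ℤP.neg-involutive (+ α x)) (ℤP.neg-mono-< (le⊑lt⇒< -α<d))))))
      where
      ring : ∀ d → - d ℤ.+ ℤ.1ℤ ℤ.- ℤ.1ℤ ≡ - d
      ring = solve-∀

  least-x0 : ∀ {Z} → LeastPath G fzero (fsuc x) Z →
             IsLeast (RegionEdge (fsuc x) fzero) (maxw (ceilw (negw Z)) α⁻)
  least-x0 {Z} least = attained Z least , belowₓ₀ bound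
    where
    bound : ∀ R {v} → v ∈⟦ G ⟧ → v ∈ᴿ R → maxw (ceilw (negw Z)) α⁻ ⊑ regionGraph α R (fsuc x) fzero
    bound R v∈G v∈R with maxw-sel (ceilw (negw Z)) α⁻
    ... | inj₁ eq rewrite eq = regionGraph-x0-lower R x (proj₁ (proj₂ v∈R) x) Z (leastPath-sound v∈G least)
    ... | inj₂ eq rewrite eq = regionGraph-x0-bound R x

    attained : ∀ Z → LeastPath G fzero (fsuc x) Z → RegionEdge (fsuc x) fzero (maxw (ceilw (negw Z)) α⁻)
    attained -∞ least = ⊥-elim (leastPath-sound v₀∈G least)
    attained ∞ least with unbounded-above v₀∈G clocks-nonneg x least (α x)
    ... | u , u∈G , α<uₓ = edgeₓ₀ u∈G (proj₂ (regionGraph-above (regionAt u∈G) x (satAt u∈G) α<uₓ))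
    attained (fin le d) least with attains-upper-le v₀∈G clocks-nonneg x least | d ℤ.≤? + α x
    ... | u , u∈G , uₓ≡ | yes d≤α = edgeₓ₀ u∈G
      (trans (proj₂ (regionGraph-at-integer (regionAt u∈G) x (satAt u∈G) d uₓ≡ d≤α))
             (sym (maxw-≡ˡ (lt⊑fin (ℤP.neg-mono-≤ d≤α)))))
    ... | u , u∈G , uₓ≡ | no d≰α = edgeₓ₀ u∈G
      (trans (proj₂ (regionGraph-above (regionAt u∈G) x (satAt u∈G)
                       (subst (toℚ (+ α x) ℚ.<_) (sym uₓ≡) (toℚ-mono-< α<d))))
             (sym (maxw-≡ʳ (fin< (ℤP.neg-mono-< α<d)))))
      where
      α<d : + α x ℤ.< d
      α<d = ℤP.≰⇒> d≰α
    attained (fin lt d) least with attains-upper-lt v₀∈G clocks-nonneg x least | d ℤ.≤? + α x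
    ... | u , u∈G , lo , hi | yes d≤α = edgeₓ₀ u∈G
      (trans (proj₂ (regionGraph-between (regionAt u∈G) x (satAt u∈G) d lo hi d≤α))
             (trans (cong (fin lt) (ring d))
                    (sym (maxw-≡ˡ (lt⊑fin (subst (- (+ α x) ℤ.≤_) (ring d)
                                               (ℤP.neg-mono-≤ (ℤP.≤-trans (ℤP.<⇒≤ (i-1<i d)) d≤α))))))))
      where
      ring : ∀ d → - (d ℤ.- ℤ.1ℤ) ≡ - d ℤ.+ ℤ.1ℤ
      ring = solve-∀
    ... | u , u∈G , lo , hi | no d≰α = edgeₓ₀ u∈G
      (trans (proj₂ (regionGraph-above (regionAt u∈G) x (satAt u∈G)
                       (ℚP.≤-<-trans (toℚ-mono-≤ (i<j⇒i≤j-1 α<d)) lo)))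
             (sym (maxw-≡ʳ (lt⊑fin (i<j⇒1-j≤-i α<d)))))
      where
      α<d : + α x ℤ.< d
      α<d = ℤP.≰⇒> d≰α

lemma3 : (n : ℕ) (α : Fin n → ℕ) (G : DistGraph n) →
    (∃ λ v → v ∈⟦ G ⟧) →
    (∀ y → G (fsuc y) fzero ≤w fin le (+ 0)) →
    (x : Fin n) (Zx0 Z0x : Weight) →
    LeastPath G (fsuc x) fzero Zx0 →
    LeastPath G fzero (fsuc x) Z0x →
    let R0x = λ w → ∃ λ (R : Region α) → (∃ λ v → v ∈⟦ G ⟧ × v ∈ᴿ R) × LeastPath (regionGraph α R) fzero (fsuc x) w
        Rx0 = λ w → ∃ λ (R : Region α) → (∃ λ v → v ∈⟦ G ⟧ × v ∈ᴿ R) × LeastPath (regionGraph α R) (fsuc x) fzero w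
    in ((Zx0 <w fin le (- (+ α x)) → IsLeast R0x ∞)
        × (¬ (Zx0 <w fin le (- (+ α x))) → IsLeast R0x (ceilw (negw Zx0))))
       × IsLeast Rx0 (maxw (ceilw (negw Z0x)) (fin lt (- (+ α x))))
lemma3 n α G (v₀ , v₀∈G) clocks-nonneg x Zx0 Z0x leastₓ₀ least₀ₓ =
  (least-0x-beyond leastₓ₀ , least-0x leastₓ₀) , least-x0 least₀ₓ
  where open RegionEdges α v₀∈G clocks-nonneg x
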